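{- Let $d\ge 0$. For $0\le\ell\le\lfloor d/2\rfloor$, $[x^\ell]Q_{d,d+1}(x)=[x^{d+1-\ell}]Q_{d,0}(x)$.
   Context: For $j\ge 0$ let $g(L_j,x)=\sum_{m=0}^{\lfloor j/2\rfloor}\frac{1}{j-m+1}\binom{j}{m}\binom{2j-2m}{j}(x-1)^m$. Define $Q_{d,0}(x)=(x-1)^{d+1}+\sum_{j=0}^{d}2^{d-j}\binom{d}{j}(x-1)^{d-j}g(L_j,x)$ and $Q_{d,d+1}(x)=g(L_d,x)$. $[x^\ell]p(x)$ denotes the coefficient of $x^\ell$ in $p(x)$. -}

module Defs where

open import Data.Nat using (ℕ; zero; suc; _+_; _∸_; _^_; _/_)
open import Data.Nat.Combinatorics using (_C_)
open import Data.Integer using (+_; -[1+_])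
open import Data.Rational using (ℚ; 0ℚ; 1ℚ) renaming (_+_ to _+ℚ_; _*_ to _*ℚ_; _/_ to _/ℚ_)
open import Data.List using (List; []; _∷_; map)

-- Univariate polynomials over ℚ as coefficient lists, lowest degree first.
Poly : Set
Poly = List ℚ

addP : Poly → Poly → Poly
addP [] q = q
addP p [] = p
addP (a ∷ p) (b ∷ q) = (a +ℚ b) ∷ addP p q

scaleP : ℚ → Poly → Poly
scaleP c p = map (c *ℚ_) p

mulP : Poly → Poly → Poly
mulP [] q = []
mulP (a ∷ p) q = addP (scaleP a q) (0ℚ ∷ mulP p q)

powP : Poly → ℕ → Poly
powP p zero = 1ℚ ∷ []
powP p (suc n) = mulP p (powP p n)

xm1 : Poly
xm1 = -[1+ 0 ] /ℚ 1 ∷ 1ℚ ∷ []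

coeff : Poly → ℕ → ℚ
coeff [] _ = 0ℚ
coeff (a ∷ p) zero = a
coeff (a ∷ p) (suc l) = coeff p l

sumP : (ℕ → Poly) → ℕ → Poly
sumP f zero = []
sumP f (suc n) = addP (sumP f n) (f n)

ℕtoℚ : ℕ → ℚ
ℕtoℚ n = (+ n) /ℚ 1

-- g(L_j, x) = Σ_{m=0}^{⌊j/2⌋} 1/(j-m+1) C(j,m) C(2j-2m,j) (x-1)^m
gL : ℕ → Poly
gL j = sumP (λ m → scaleP ((+ ((j C m) Data.Nat.* ((2 Data.Nat.* j ∸ 2 Data.Nat.* m) C j))) /ℚ suc (j ∸ m))
                          (powP xm1 m))
            (suc (j / 2))

-- Q_{d,0}(x) = (x-1)^{d+1} + Σ_{j=0}^{d} 2^{d-j} C(d,j) (x-1)^{d-j} g(L_j,x)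
Q0 : ℕ → Poly
Q0 d = addP (powP xm1 (suc d))
            (sumP (λ j → scaleP (ℕtoℚ (2 ^ (d ∸ j) Data.Nat.* (d C j)))
                                (mulP (powP xm1 (d ∸ j)) (gL j)))
                  (suc d))

-- Q_{d,d+1}(x) = g(L_d, x)
Qlast : ℕ → Poly
Qlast d = gL d

-- Write y = x - 1.  Since (1/(j-m+1)) (j choose m) (2j-2m choose j) = Cat(j-m) (j-m choose m), the series
-- G = ∑ g(L_d) t^d equals C(t (1 + y t)), where the Catalan series C = ∑ Cat(n) tⁿ satisfies C = 1 + t C².
-- Hence the series of reversals L = ∑ x^(d+1) g(L_d)(1/x) t^d = x C(x t (1 - y t)) solves L = x + t (1 - y t) L².
-- The series of the Q_{d,0} is M = ∑ y^(d+1) t^d + R G(t R) with R = 1/(1 - 2yt), and a direct computation shows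
-- that M solves the same equation, whose solution is unique.  So Q_{d,0}(x) = x^(d+1) g(L_d)(1/x), and the claim
-- compares coefficients.  The Catalan equation comes from (n+2) Cat(n+1) = 2(2n+1) Cat(n): this ODE makes
-- F = (1 - 2tC)² satisfy (1 - 4t) F′ = -4F, so F = 1 - 4t, which is 4t (1 + tC² - C) = 0.

module Submission where

open import Defs
open import Level using (0ℓ)
open import Algebra.Bundles using (CommutativeRing)
open import Data.Nat as ℕ using (ℕ; zero; suc; _∸_; _/_; _≤_; _<_; _≟_; z≤n; s≤s)
import Data.Nat.Properties as ℕₚ
open ℕₚ using (≤-refl; ≤-trans; <-≤-trans; ≤-pred; <⇒≢; ≤∧≢⇒<; ≰⇒>; m≤n⇒m<n∨m≡n; n<1+n; m<n⇒m<1+n;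
              m≤m+n; m≤n+m; +-suc; +-monoʳ-<; +-∸-assoc; ∸-+-assoc; n∸n≡0; m∸n≤m; m∸[m∸n]≡n; m+[n∸m]≡n;
              m∸n+n≡m; m+n∸m≡n; m+n∸n≡m; ∸-monoʳ-<; ∸-monoʳ-≤; m+n≤o⇒m≤o∸n; m<n+o⇒m∸n<o)
open import Data.Nat.Combinatorics using (_C_; nCk+nC[k+1]≡[n+1]C[k+1]; nCn≡1; nCk≡nC[n∸k]; k>n⇒nCk≡0)
open import Data.Sum using (inj₁; inj₂)
open import Data.Product using (_,_)
open import Data.List using ([]; _∷_)
open import Function using (_∘_)
open import Data.Maybe using (Maybe; just; nothing)
open import Data.Integer as ℤ using (ℤ; +_)
import Data.Integer.Properties as ℤₚ
open import Data.Rational as ℚ using (ℚ)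
import Data.Rational.Properties as ℚₚ
open import Algebra.Solver.Ring.AlmostCommutativeRing using (_-Raw-AlmostCommutative⟶_; fromCommutativeRing)
import Algebra.Solver.Ring
import Data.Nat.Solver
open import Relation.Nullary using (yes; no; contradiction)
open import Relation.Binary.PropositionalEquality as ≡ using (_≡_; _≢_)

module FiniteSum {c ℓ} (R : CommutativeRing c ℓ) where
  open CommutativeRing R
  open import Relation.Binary.Reasoning.Setoid setoid

  ∑ : (ℕ → Carrier) → ℕ → Carrier
  ∑ f zero    = 0#
  ∑ f (suc n) = ∑ f n + f n

  ∑-cong< : ∀ {f g} n → (∀ i → i < n → f i ≈ g i) → ∑ f n ≈ ∑ g n
  ∑-cong< zero    f≈g = refl
  ∑-cong< (suc n) f≈g = +-cong (∑-cong< n (λ i i<n → f≈g i (m<n⇒m<1+n i<n))) (f≈g n (n<1+n n))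

  ∑-cong : ∀ {f g} n → (∀ i → f i ≈ g i) → ∑ f n ≈ ∑ g n
  ∑-cong n f≈g = ∑-cong< n (λ i _ → f≈g i)

  ∑-zero : ∀ {f} n → (∀ i → i < n → f i ≈ 0#) → ∑ f n ≈ 0#
  ∑-zero zero    f≈0 = refl
  ∑-zero (suc n) f≈0 =
    trans (+-cong (∑-zero n (λ i i<n → f≈0 i (m<n⇒m<1+n i<n))) (f≈0 n (n<1+n n))) (+-identityˡ 0#)

  ∑-distrib-+ : ∀ f g n → ∑ (λ i → f i + g i) n ≈ ∑ f n + ∑ g n
  ∑-distrib-+ f g zero    = sym (+-identityˡ 0#)
  ∑-distrib-+ f g (suc n) = begin
    ∑ (λ i → f i + g i) n + (f n + g n)  ≈⟨ +-congʳ (∑-distrib-+ f g n) ⟩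
    (∑ f n + ∑ g n) + (f n + g n)        ≈⟨ +-assoc _ _ _ ⟩
    ∑ f n + (∑ g n + (f n + g n))        ≈⟨ +-congˡ (x∙yz≈y∙xz _ _ _) ⟩
    ∑ f n + (f n + (∑ g n + g n))        ≈⟨ sym (+-assoc _ _ _) ⟩
    (∑ f n + f n) + (∑ g n + g n)        ∎
    where open import Algebra.Properties.CommutativeSemigroup +-commutativeSemigroup using (x∙yz≈y∙xz)

  *-distribˡ-∑ : ∀ a f n → a * ∑ f n ≈ ∑ (λ i → a * f i) n
  *-distribˡ-∑ a f zero    = zeroʳ a
  *-distribˡ-∑ a f (suc n) = trans (distribˡ a (∑ f n) (f n)) (+-congʳ (*-distribˡ-∑ a f n))

  *-distribʳ-∑ : ∀ a f n → ∑ f n * a ≈ ∑ (λ i → f i * a) n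
  *-distribʳ-∑ a f n = trans (*-comm _ a) (trans (*-distribˡ-∑ a f n) (∑-cong n (λ i → *-comm a (f i))))

  ∑-shift : ∀ f n → ∑ f (suc n) ≈ f 0 + ∑ (λ i → f (suc i)) n
  ∑-shift f zero    = trans (+-identityˡ _) (sym (+-identityʳ _))
  ∑-shift f (suc n) = trans (+-congʳ (∑-shift f n)) (+-assoc _ _ _)

  ∑-extend : ∀ {f} n m → n ≤ m → (∀ i → n ≤ i → i < m → f i ≈ 0#) → ∑ f m ≈ ∑ f n
  ∑-extend {f} n zero    z≤n _   = refl
  ∑-extend {f} n (suc m) n≤1+m f≈0 with m≤n⇒m<n∨m≡n n≤1+m
  ... | inj₂ ≡.refl   = refl
  ... | inj₁ n<1+m  = begin
    ∑ f m + f m  ≈⟨ +-cong (∑-extend n m n≤m (λ i n≤i i<m → f≈0 i n≤i (m<n⇒m<1+n i<m))) (f≈0 m n≤m (n<1+n m)) ⟩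
    ∑ f n + 0#   ≈⟨ +-identityʳ _ ⟩
    ∑ f n        ∎
    where n≤m = ≤-pred n<1+m

  ∑-reverse : ∀ f n → ∑ f n ≈ ∑ (λ i → f (n ∸ suc i)) n
  ∑-reverse f zero    = refl
  ∑-reverse f (suc n) = begin
    ∑ f (suc n)                            ≈⟨ ∑-shift f n ⟩
    f 0 + ∑ (λ i → f (suc i)) n            ≈⟨ +-congˡ (∑-reverse (λ i → f (suc i)) n) ⟩
    f 0 + ∑ (λ i → f (suc (n ∸ suc i))) n  ≈⟨ +-congˡ (∑-cong< n (λ i i<n → reflexive (≡.cong f (≡.sym (+-∸-assoc 1 i<n))))) ⟩
    f 0 + ∑ (λ i → f (n ∸ i)) n            ≈⟨ +-comm _ _ ⟩
    ∑ (λ i → f (n ∸ i)) n + f 0            ≡⟨ ≡.cong (λ k → ∑ (λ i → f (n ∸ i)) n + f k) (≡.sym (n∸n≡0 n)) ⟩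
    ∑ (λ i → f (n ∸ i)) n + f (n ∸ n)      ∎

  ∑-swap : ∀ (f : ℕ → ℕ → Carrier) m n → ∑ (λ i → ∑ (f i) n) m ≈ ∑ (λ j → ∑ (λ i → f i j) m) n
  ∑-swap f zero    n = sym (∑-zero n (λ _ _ → refl))
  ∑-swap f (suc m) n = begin
    ∑ (λ i → ∑ (f i) n) m + ∑ (f m) n               ≈⟨ +-congʳ (∑-swap f m n) ⟩
    ∑ (λ j → ∑ (λ i → f i j) m) n + ∑ (f m) n       ≈⟨ sym (∑-distrib-+ _ _ n) ⟩
    ∑ (λ j → ∑ (λ i → f i j) m + f m j) n           ∎

  ∑-triangle : ∀ (f : ℕ → ℕ → Carrier) n →
               ∑ (λ k → ∑ (λ i → f i (k ∸ i)) (suc k)) (suc n) ≈ ∑ (λ i → ∑ (f i) (suc (n ∸ i))) (suc n)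
  ∑-triangle f zero    = refl
  ∑-triangle f (suc n) = begin
    ∑ (λ k → ∑ (λ i → f i (k ∸ i)) (suc k)) (suc (suc n))
      ≈⟨ ∑-cong (suc (suc n)) (λ k → ∑-shift (λ i → f i (k ∸ i)) k) ⟩
    ∑ (λ k → f 0 k + ∑ (λ i → f (suc i) (k ∸ suc i)) k) (suc (suc n))
      ≈⟨ ∑-distrib-+ _ _ (suc (suc n)) ⟩
    ∑ (f 0) (suc (suc n)) + ∑ (λ k → ∑ (λ i → f (suc i) (k ∸ suc i)) k) (suc (suc n))
      ≈⟨ +-congˡ (trans (∑-shift _ (suc n)) (+-identityˡ _)) ⟩
    ∑ (f 0) (suc (suc n)) + ∑ (λ k → ∑ (λ i → f (suc i) (k ∸ i)) (suc k)) (suc n)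
      ≈⟨ +-congˡ (∑-triangle (λ i → f (suc i)) n) ⟩
    ∑ (f 0) (suc (suc n)) + ∑ (λ i → ∑ (f (suc i)) (suc (n ∸ i))) (suc n)
      ≈⟨ sym (∑-shift _ (suc n)) ⟩
    ∑ (λ i → ∑ (f i) (suc (suc n ∸ i))) (suc (suc n)) ∎

  ∑-single : ∀ {f} n k → k < n → (∀ i → i < n → i ≢ k → f i ≈ 0#) → ∑ f n ≈ f k
  ∑-single {f} (suc n) k k<1+n f≈0 with k ≟ n
  ... | yes ≡.refl = trans (+-congʳ (∑-zero n (λ i i<n → f≈0 i (m<n⇒m<1+n i<n) (<⇒≢ i<n)))) (+-identityˡ _)
  ... | no k≢n   = trans (+-cong (∑-single n k (≤∧≢⇒< (≤-pred k<1+n) k≢n) (λ i i<n → f≈0 i (m<n⇒m<1+n i<n)))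
                                 (f≈0 n (n<1+n n) (k≢n ∘ ≡.sym)))
                         (+-identityʳ _)

module PowerSeries {c ℓ} (R : CommutativeRing c ℓ) where
  open CommutativeRing R
  open import Relation.Binary.Reasoning.Setoid setoid
  open FiniteSum R public

  Series : Set c
  Series = ℕ → Carrier

  infix  4 _≋_
  infixl 6 _⊕_
  infixl 7 _⊛_
  infix  8 ⊝_

  _≋_ : Series → Series → Set ℓ
  f ≋ g = ∀ n → f n ≈ g n

  _⊕_ : Series → Series → Series
  (f ⊕ g) n = f n + g n

  _⊛_ : Series → Series → Series
  (f ⊛ g) n = ∑ (λ i → f i * g (n ∸ i)) (suc n)

  ⊝_ : Series → Series
  (⊝ f) n = - f n

  𝟘 : Series
  𝟘 n = 0#

  const : Carrier → Series
  const a zero    = a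
  const a (suc n) = 0#

  -- Defined through const so that, in a series algebra, the solver's constant 1 is definitionally 𝟙.
  𝟙 : Series
  𝟙 = const 1#

  ⊛-cong : ∀ {f f′ g g′} → f ≋ f′ → g ≋ g′ → f ⊛ g ≋ f′ ⊛ g′
  ⊛-cong f≋f′ g≋g′ n = ∑-cong (suc n) (λ i → *-cong (f≋f′ i) (g≋g′ (n ∸ i)))

  ⊛-comm : ∀ f g → f ⊛ g ≋ g ⊛ f
  ⊛-comm f g n = begin
    ∑ (λ i → f i * g (n ∸ i)) (suc n)              ≈⟨ ∑-reverse _ (suc n) ⟩
    ∑ (λ i → f (n ∸ i) * g (n ∸ (n ∸ i))) (suc n)  ≈⟨ ∑-cong< (suc n) (λ i i<1+n →
                                                        trans (*-comm _ _) (*-congʳ (reflexive (≡.cong g (m∸[m∸n]≡n (≤-pred i<1+n)))))) ⟩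
    ∑ (λ i → g i * f (n ∸ i)) (suc n)              ∎

  ⊛-identityˡ : ∀ g → 𝟙 ⊛ g ≋ g
  ⊛-identityˡ g n = begin
    ∑ (λ i → 𝟙 i * g (n ∸ i)) (suc n)          ≈⟨ ∑-shift _ n ⟩
    1# * g n + ∑ (λ i → 0# * g (n ∸ suc i)) n  ≈⟨ +-cong (*-identityˡ _) (∑-zero n (λ i _ → zeroˡ _)) ⟩
    g n + 0#                                   ≈⟨ +-identityʳ _ ⟩
    g n                                        ∎

  ⊛-distribˡ : ∀ f g h → f ⊛ (g ⊕ h) ≋ f ⊛ g ⊕ f ⊛ h
  ⊛-distribˡ f g h n = trans (∑-cong (suc n) (λ i → distribˡ _ _ _)) (∑-distrib-+ _ _ (suc n))

  ⊛-assoc : ∀ f g h → (f ⊛ g) ⊛ h ≋ f ⊛ (g ⊛ h)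
  ⊛-assoc f g h n = begin
    ∑ (λ k → ∑ (λ i → f i * g (k ∸ i)) (suc k) * h (n ∸ k)) (suc n)
      ≈⟨ ∑-cong (suc n) (λ k → *-distribʳ-∑ _ _ (suc k)) ⟩
    ∑ (λ k → ∑ (λ i → f i * g (k ∸ i) * h (n ∸ k)) (suc k)) (suc n)
      ≈⟨ ∑-cong (suc n) (λ k → ∑-cong< (suc k) (λ i i<1+k →
           reflexive (≡.cong (λ m → f i * g (k ∸ i) * h (n ∸ m)) (≡.sym (m+[n∸m]≡n (≤-pred i<1+k)))))) ⟩
    ∑ (λ k → ∑ (λ i → F i (k ∸ i)) (suc k)) (suc n)
      ≈⟨ ∑-triangle F n ⟩
    ∑ (λ i → ∑ (F i) (suc (n ∸ i))) (suc n)
      ≈⟨ ∑-cong (suc n) (λ i → trans (∑-cong (suc (n ∸ i)) (λ j →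
           trans (*-assoc _ _ _) (reflexive (≡.cong (λ m → f i * (g j * h m)) (≡.sym (∸-+-assoc n i j))))))
           (sym (*-distribˡ-∑ _ _ (suc (n ∸ i))))) ⟩
    ∑ (λ i → f i * ∑ (λ j → g j * h (n ∸ i ∸ j)) (suc (n ∸ i))) (suc n) ∎
    where F = λ i j → f i * g j * h (n ∸ (i ℕ.+ j))

  ⊕-⊛-commutativeRing : CommutativeRing c ℓ
  ⊕-⊛-commutativeRing = record
    { Carrier = Series ; _≈_ = _≋_ ; _+_ = _⊕_ ; _*_ = _⊛_ ; -_ = ⊝_ ; 0# = 𝟘 ; 1# = 𝟙
    ; isCommutativeRing = record
      { isRing = record
        { +-isAbelianGroup = record
          { isGroup = record
            { isMonoid = record
              { isSemigroup = record
                { isMagma = record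
                  { isEquivalence = record
                    { refl = λ n → refl ; sym = λ e n → sym (e n) ; trans = λ e e′ n → trans (e n) (e′ n) }
                  ; ∙-cong = λ e e′ n → +-cong (e n) (e′ n) }
                ; assoc = λ f g h n → +-assoc _ _ _ }
              ; identity = (λ f n → +-identityˡ _) , (λ f n → +-identityʳ _) }
            ; inverse = (λ f n → -‿inverseˡ _) , (λ f n → -‿inverseʳ _)
            ; ⁻¹-cong = λ e n → -‿cong (e n) }
          ; comm = λ f g n → +-comm _ _ }
        ; *-cong = ⊛-cong
        ; *-assoc = ⊛-assoc
        ; *-identity = ⊛-identityˡ , (λ g n → trans (⊛-comm g 𝟙 n) (⊛-identityˡ g n))
        ; distrib = ⊛-distribˡ , (λ f g h n → trans (⊛-comm (g ⊕ h) f n)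
                                               (trans (⊛-distribˡ f g h n) (+-cong (⊛-comm f g n) (⊛-comm f h n))))
        }
      ; *-comm = ⊛-comm
      }
    }

  module Sᵣ = CommutativeRing ⊕-⊛-commutativeRing
  open import Algebra.Properties.CommutativeSemiring.Exp commutativeSemiring public using (_^_; ^-homo-*; ^-distrib-*)
  open import Algebra.Properties.CommutativeSemiring.Exp Sᵣ.commutativeSemiring public
    using () renaming (_^_ to _^ₛ_; ^-congˡ to ^ₛ-congˡ; ^-homo-* to ^ₛ-homo-*; ^-distrib-* to ^ₛ-distrib-⊛)
  open import Algebra.Properties.CommutativeSemigroup *-commutativeSemigroup using (x∙yz≈y∙xz; interchange)

  t : Series
  t zero          = 0#
  t (suc zero)    = 1#
  t (suc (suc n)) = 0#

  const-cong : ∀ {a b} → a ≈ b → const a ≋ const b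
  const-cong a≈b zero    = a≈b
  const-cong a≈b (suc n) = refl

  const-⊛ : ∀ a f n → (const a ⊛ f) n ≈ a * f n
  const-⊛ a f n = begin
    ∑ (λ i → const a i * f (n ∸ i)) (suc n)     ≈⟨ ∑-shift _ n ⟩
    a * f n + ∑ (λ i → 0# * f (n ∸ suc i)) n    ≈⟨ +-congˡ (∑-zero n (λ i _ → zeroˡ _)) ⟩
    a * f n + 0#                                ≈⟨ +-identityʳ _ ⟩
    a * f n                                     ∎

  const-+ : ∀ a b → const (a + b) ≋ const a ⊕ const b
  const-+ a b zero    = refl
  const-+ a b (suc n) = sym (+-identityˡ _)

  const-* : ∀ a b → const (a * b) ≋ const a ⊛ const b
  const-* a b zero    = sym (const-⊛ a (const b) 0)
  const-* a b (suc n) = sym (trans (const-⊛ a (const b) (suc n)) (zeroʳ a))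

  const‿- : ∀ a → const (- a) ≋ ⊝ const a
  const‿- a zero    = refl
  const‿- a (suc n) = sym -0#≈0#
    where open import Algebra.Properties.Ring ring using (-0#≈0#)

  const-^ : ∀ a n → const a ^ₛ n ≋ const (a ^ n)
  const-^ a zero    zero    = refl
  const-^ a zero    (suc k) = refl
  const-^ a (suc n) = Sᵣ.trans (Sᵣ.*-congˡ (const-^ a n)) (Sᵣ.sym (const-* a (a ^ n)))

  t⊛-zero : ∀ f → (t ⊛ f) 0 ≈ 0#
  t⊛-zero f = trans (+-identityˡ _) (zeroˡ _)

  t⊛-suc : ∀ f n → (t ⊛ f) (suc n) ≈ f n
  t⊛-suc f n = begin
    ∑ (λ i → t i * f (suc n ∸ i)) (suc (suc n))                        ≈⟨ ∑-shift _ (suc n) ⟩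
    0# * f (suc n) + ∑ (λ i → t (suc i) * f (n ∸ i)) (suc n)           ≈⟨ +-cong (zeroˡ _) (∑-shift _ n) ⟩
    0# + (1# * f n + ∑ (λ i → t (suc (suc i)) * f (n ∸ suc i)) n)      ≈⟨ +-identityˡ _ ⟩
    1# * f n + ∑ (λ i → 0# * f (n ∸ suc i)) n                          ≈⟨ +-cong (*-identityˡ _) (∑-zero n (λ i _ → zeroˡ _)) ⟩
    f n + 0#                                                           ≈⟨ +-identityʳ _ ⟩
    f n                                                                ∎

  t⊛-cancel : ∀ {f g} → t ⊛ f ≋ t ⊛ g → f ≋ g
  t⊛-cancel {f} {g} tf≋tg n = trans (sym (t⊛-suc f n)) (trans (tf≋tg (suc n)) (t⊛-suc g n))

  t^n⊛-+ : ∀ n f d → (t ^ₛ n ⊛ f) (n ℕ.+ d) ≈ f d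
  t^n⊛-+ zero    f d = ⊛-identityˡ f d
  t^n⊛-+ (suc n) f d = trans (⊛-assoc t (t ^ₛ n) f (suc (n ℕ.+ d))) (trans (t⊛-suc (t ^ₛ n ⊛ f) (n ℕ.+ d)) (t^n⊛-+ n f d))

  t^n⊛-< : ∀ n f d → d < n → (t ^ₛ n ⊛ f) d ≈ 0#
  t^n⊛-< (suc n) f zero    _           = trans (⊛-assoc t (t ^ₛ n) f 0) (t⊛-zero (t ^ₛ n ⊛ f))
  t^n⊛-< (suc n) f (suc d) (s≤s d<n)   = trans (⊛-assoc t (t ^ₛ n) f (suc d)) (trans (t⊛-suc (t ^ₛ n ⊛ f) d) (t^n⊛-< n f d d<n))

  t^n⊛-≥ : ∀ n f d → n ≤ d → (t ^ₛ n ⊛ f) d ≈ f (d ∸ n)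
  t^n⊛-≥ n f d n≤d = trans (reflexive (≡.cong (t ^ₛ n ⊛ f) (≡.sym (m+[n∸m]≡n n≤d)))) (t^n⊛-+ n f (d ∸ n))

  [t⊛g]^n-≥ : ∀ g n d → n ≤ d → ((t ⊛ g) ^ₛ n) d ≈ (g ^ₛ n) (d ∸ n)
  [t⊛g]^n-≥ g n d n≤d = trans (^ₛ-distrib-⊛ t g n d) (t^n⊛-≥ n (g ^ₛ n) d n≤d)

  ∑ₛ-coeff : ∀ (F : ℕ → Series) m n → FiniteSum.∑ ⊕-⊛-commutativeRing F m n ≈ ∑ (λ j → F j n) m
  ∑ₛ-coeff F zero    n = refl
  ∑ₛ-coeff F (suc m) n = +-congʳ (∑ₛ-coeff F m n)

  infix 4 _≋[≤_]_
  _≋[≤_]_ : Series → ℕ → Series → Set ℓ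
  f ≋[≤ d ] g = ∀ k → k ≤ d → f k ≈ g k

  ⊛-cong-≤ : ∀ {f f′ g g′} d → f ≋[≤ d ] f′ → g ≋[≤ d ] g′ → f ⊛ g ≋[≤ d ] f′ ⊛ g′
  ⊛-cong-≤ d f≋f′ g≋g′ k k≤d = ∑-cong< (suc k) (λ i i<1+k →
    *-cong (f≋f′ i (≤-trans (≤-pred i<1+k) k≤d)) (g≋g′ (k ∸ i) (≤-trans (m∸n≤m k i) k≤d)))

  -- The coefficient of t^(d+1) on the right only involves coefficients of u up to t^d.
  quadratic-unique : ∀ {K W u v} → u ≋ K ⊕ t ⊛ (W ⊛ (u ⊛ u)) → v ≋ K ⊕ t ⊛ (W ⊛ (v ⊛ v)) → u ≋ v
  quadratic-unique {K} {W} {u} {v} u≋ v≋ n = agree n n ≤-refl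
    where
    agree : ∀ d → u ≋[≤ d ] v
    agree zero    zero    _ = trans (u≋ 0) (trans (+-congˡ (trans (t⊛-zero (W ⊛ (u ⊛ u))) (sym (t⊛-zero (W ⊛ (v ⊛ v)))))) (sym (v≋ 0)))
    agree (suc d) k k≤1+d with m≤n⇒m<n∨m≡n k≤1+d
    ... | inj₁ k<1+d  = agree d k (≤-pred k<1+d)
    ... | inj₂ ≡.refl = trans (u≋ (suc d)) (trans (+-congˡ (trans (t⊛-suc (W ⊛ (u ⊛ u)) d) (trans
                          (⊛-cong-≤ d (λ _ _ → refl) (⊛-cong-≤ d (agree d) (agree d)) d ≤-refl)
                          (sym (t⊛-suc (W ⊛ (v ⊛ v)) d)))))
                        (sym (v≋ (suc d))))

  module Composition (P : Series) (P₀≈0 : P 0 ≈ 0#) where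

    P^n-< : ∀ n d → d < n → (P ^ₛ n) d ≈ 0#
    P^n-< (suc n) d d<1+n = ∑-zero (suc d) term
      where
      term : ∀ i → i < suc d → P i * (P ^ₛ n) (d ∸ i) ≈ 0#
      term zero    _         = trans (*-congʳ P₀≈0) (zeroˡ _)
      term (suc i) 1+i<1+d   = trans (*-congˡ (P^n-< n (d ∸ suc i)
        (<-≤-trans (∸-monoʳ-< {d} {suc i} {0} (s≤s z≤n) (≤-pred 1+i<1+d)) (≤-pred d<1+n)))) (zeroʳ _)

    -- Truncated at n = d: the terms with n > d vanish since P has no constant term.
    infix 9 _∘P
    _∘P : Series → Series
    (f ∘P) d = ∑ (λ n → f n * (P ^ₛ n) d) (suc d)

    ∘P-extend : ∀ f d m → d < m → (f ∘P) d ≈ ∑ (λ n → f n * (P ^ₛ n) d) m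
    ∘P-extend f d m d<m = sym (∑-extend (suc d) m d<m (λ i 1+d≤i _ → trans (*-congˡ (P^n-< i d 1+d≤i)) (zeroʳ _)))

    ∘P-cong : ∀ {f g} → f ≋ g → f ∘P ≋ g ∘P
    ∘P-cong f≋g d = ∑-cong (suc d) (λ n → *-congʳ (f≋g n))

    ∘P-+ : ∀ f g → (f ⊕ g) ∘P ≋ f ∘P ⊕ g ∘P
    ∘P-+ f g d = trans (∑-cong (suc d) (λ n → distribʳ _ _ _)) (∑-distrib-+ _ _ (suc d))

    ∘P-𝟙 : 𝟙 ∘P ≋ 𝟙
    ∘P-𝟙 d = trans (∑-shift _ d) (trans (+-cong (*-identityˡ _) (∑-zero d (λ i _ → zeroˡ _))) (+-identityʳ _))

    ∘P-t : t ∘P ≋ P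
    ∘P-t zero    = trans (+-identityˡ _) (trans (zeroˡ _) (sym P₀≈0))
    ∘P-t (suc d) = trans (∑-single (suc (suc d)) 1 (s≤s (s≤s z≤n)) vanish)
                         (trans (*-identityˡ _) (Sᵣ.*-identityʳ P (suc d)))
      where
      vanish : ∀ i → i < suc (suc d) → i ≢ 1 → t i * (P ^ₛ i) (suc d) ≈ 0#
      vanish zero          _ _   = zeroˡ _
      vanish (suc zero)    _ i≢1 = contradiction ≡.refl i≢1
      vanish (suc (suc i)) _ _   = zeroˡ _

    ∘P-const : ∀ a → const a ∘P ≋ const a
    ∘P-const a d = trans (∑-shift _ d) (trans (+-congˡ (∑-zero d (λ i _ → zeroˡ _))) (trans (+-identityʳ _) (a*𝟙≈const a d)))
      where
      a*𝟙≈const : ∀ a d → a * 𝟙 d ≈ const a d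
      a*𝟙≈const a zero    = *-identityʳ a
      a*𝟙≈const a (suc d) = zeroʳ a

    ∘P-⊛ : ∀ f g → (f ⊛ g) ∘P ≋ f ∘P ⊛ g ∘P
    ∘P-⊛ f g d = sym (begin
      ∑ (λ i → (f ∘P) i * (g ∘P) (d ∸ i)) N
        ≈⟨ ∑-cong< N (λ i i<N → *-cong (∘P-extend f i N i<N) (∘P-extend g (d ∸ i) N (s≤s (m∸n≤m d i)))) ⟩
      ∑ (λ i → ∑ (λ a → f a * (P ^ₛ a) i) N * ∑ (λ b → g b * (P ^ₛ b) (d ∸ i)) N) N
        ≈⟨ ∑-cong N (λ i → trans (*-distribʳ-∑ _ _ N) (∑-cong N (λ a → trans (*-distribˡ-∑ _ _ N) (∑-cong N (λ b → interchange _ _ _ _))))) ⟩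
      ∑ (λ i → ∑ (λ a → ∑ (λ b → (f a * g b) * ((P ^ₛ a) i * (P ^ₛ b) (d ∸ i))) N) N) N
        ≈⟨ ∑-swap _ N N ⟩
      ∑ (λ a → ∑ (λ i → ∑ (λ b → (f a * g b) * ((P ^ₛ a) i * (P ^ₛ b) (d ∸ i))) N) N) N
        ≈⟨ ∑-cong N (λ a → ∑-swap _ N N) ⟩
      ∑ (λ a → ∑ (λ b → ∑ (λ i → (f a * g b) * ((P ^ₛ a) i * (P ^ₛ b) (d ∸ i))) N) N) N
        ≈⟨ ∑-cong N (λ a → ∑-cong N (λ b → trans (sym (*-distribˡ-∑ _ _ N)) (*-congˡ (Sᵣ.sym (^ₛ-homo-* P a b) d)))) ⟩
      ∑ (λ a → ∑ (H a) N) N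
        ≈⟨ ∑-cong< N (λ a a<N → ∑-extend (suc (d ∸ a)) N (s≤s (m∸n≤m d a)) (λ b 1+d-a≤b _ →
             trans (*-congˡ (P^n-< (a ℕ.+ b) d (beyond a b (≤-pred a<N) 1+d-a≤b))) (zeroʳ _))) ⟩
      ∑ (λ a → ∑ (H a) (suc (d ∸ a))) N
        ≈⟨ sym (∑-triangle H d) ⟩
      ∑ (λ n → ∑ (λ a → H a (n ∸ a)) (suc n)) N
        ≈⟨ ∑-cong N (λ n → ∑-cong< (suc n) (λ a a<1+n → *-congˡ (reflexive (≡.cong (λ m → (P ^ₛ m) d) (m+[n∸m]≡n (≤-pred a<1+n)))))) ⟩
      ∑ (λ n → ∑ (λ a → (f a * g (n ∸ a)) * (P ^ₛ n) d) (suc n)) N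
        ≈⟨ ∑-cong N (λ n → sym (*-distribʳ-∑ _ _ (suc n))) ⟩
      ((f ⊛ g) ∘P) d ∎)
      where
      N = suc d
      H = λ a b → (f a * g b) * (P ^ₛ (a ℕ.+ b)) d
      beyond : ∀ a b → a ≤ d → suc (d ∸ a) ≤ b → d < a ℕ.+ b
      beyond a b a≤d 1+d-a≤b = ≡.subst (_< a ℕ.+ b) (m+[n∸m]≡n a≤d) (+-monoʳ-< a 1+d-a≤b)

    ⊛-∘P : ∀ R f d → (R ⊛ f ∘P) d ≈ ∑ (λ j → f j * (R ⊛ P ^ₛ j) d) (suc d)
    ⊛-∘P R f d = begin
      ∑ (λ i → R i * (f ∘P) (d ∸ i)) N
        ≈⟨ ∑-cong N (λ i → *-congˡ (∘P-extend f (d ∸ i) N (s≤s (m∸n≤m d i)))) ⟩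
      ∑ (λ i → R i * ∑ (λ j → f j * (P ^ₛ j) (d ∸ i)) N) N
        ≈⟨ ∑-cong N (λ i → trans (*-distribˡ-∑ _ _ N) (∑-cong N (λ j → x∙yz≈y∙xz _ _ _))) ⟩
      ∑ (λ i → ∑ (λ j → f j * (R i * (P ^ₛ j) (d ∸ i))) N) N
        ≈⟨ ∑-swap _ N N ⟩
      ∑ (λ j → ∑ (λ i → f j * (R i * (P ^ₛ j) (d ∸ i))) N) N
        ≈⟨ ∑-cong N (λ j → sym (*-distribˡ-∑ _ _ N)) ⟩
      ∑ (λ j → f j * (R ⊛ P ^ₛ j) d) N ∎
      where N = suc d

    ∘P-quadratic : ∀ f → f ≋ 𝟙 ⊕ t ⊛ (f ⊛ f) → f ∘P ≋ 𝟙 ⊕ P ⊛ (f ∘P ⊛ f ∘P)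
    ∘P-quadratic f f≋ = Sᵣ.trans (∘P-cong f≋) (Sᵣ.trans (∘P-+ 𝟙 (t ⊛ (f ⊛ f))) (Sᵣ.+-cong ∘P-𝟙
      (Sᵣ.trans (∘P-⊛ t (f ⊛ f)) (Sᵣ.*-cong ∘P-t (∘P-⊛ f f)))))


module RationalCasts where
  open import Data.Integer.Solver using (module +-*-Solver)
  open +-*-Solver
  open import Data.Rational using (fromℚᵘ; toℚᵘ)
  open import Data.Rational.Unnormalised as ℚᵘ using (mkℚᵘ; *≡*)
  import Data.Rational.Unnormalised.Properties as ℚᵘₚ

  ℤtoℚ : ℤ → ℚ
  ℤtoℚ i = i ℚ./ 1

  -- i / suc n is definitionally fromℚᵘ (mkℚᵘ i n), so these identities reduce to integer ones in ℚᵘ.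
  private
    fromℚᵘ-homo-+ : ∀ p q → fromℚᵘ (p ℚᵘ.+ q) ≡ fromℚᵘ p ℚ.+ fromℚᵘ q
    fromℚᵘ-homo-+ p q = ℚₚ.toℚᵘ-injective (ℚᵘₚ.≃-trans (ℚₚ.toℚᵘ-fromℚᵘ _) (ℚᵘₚ.≃-sym
      (ℚᵘₚ.≃-trans (ℚₚ.toℚᵘ-homo-+ (fromℚᵘ p) (fromℚᵘ q)) (ℚᵘₚ.+-cong (ℚₚ.toℚᵘ-fromℚᵘ p) (ℚₚ.toℚᵘ-fromℚᵘ q)))))

    fromℚᵘ-homo-* : ∀ p q → fromℚᵘ (p ℚᵘ.* q) ≡ fromℚᵘ p ℚ.* fromℚᵘ q
    fromℚᵘ-homo-* p q = ℚₚ.toℚᵘ-injective (ℚᵘₚ.≃-trans (ℚₚ.toℚᵘ-fromℚᵘ _) (ℚᵘₚ.≃-sym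
      (ℚᵘₚ.≃-trans (ℚₚ.toℚᵘ-homo-* (fromℚᵘ p) (fromℚᵘ q)) (ℚᵘₚ.*-cong (ℚₚ.toℚᵘ-fromℚᵘ p) (ℚₚ.toℚᵘ-fromℚᵘ q)))))

    fromℚᵘ-homo‿- : ∀ p → fromℚᵘ (ℚᵘ.- p) ≡ ℚ.- fromℚᵘ p
    fromℚᵘ-homo‿- p = ℚₚ.toℚᵘ-injective (ℚᵘₚ.≃-trans (ℚₚ.toℚᵘ-fromℚᵘ _) (ℚᵘₚ.≃-sym
      (ℚᵘₚ.≃-trans (ℚₚ.toℚᵘ-homo‿- (fromℚᵘ p)) (ℚᵘₚ.-‿cong (ℚₚ.toℚᵘ-fromℚᵘ p)))))

  ℤtoℚ-homo-+ : ∀ i j → ℤtoℚ (i ℤ.+ j) ≡ ℤtoℚ i ℚ.+ ℤtoℚ j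
  ℤtoℚ-homo-+ i j = ≡.trans (ℚₚ.fromℚᵘ-cong {mkℚᵘ (i ℤ.+ j) 0} {mkℚᵘ i 0 ℚᵘ.+ mkℚᵘ j 0} (*≡* integral))
                            (fromℚᵘ-homo-+ (mkℚᵘ i 0) (mkℚᵘ j 0))
    where
    integral = solve 2 (λ i j → (i :+ j) :* con (+ 1) := (i :* con (+ 1) :+ j :* con (+ 1)) :* con (+ 1)) ≡.refl i j

  ℤtoℚ-homo-* : ∀ i j → ℤtoℚ (i ℤ.* j) ≡ ℤtoℚ i ℚ.* ℤtoℚ j
  ℤtoℚ-homo-* i j = fromℚᵘ-homo-* (mkℚᵘ i 0) (mkℚᵘ j 0)

  ℤtoℚ-homo‿- : ∀ i → ℤtoℚ (ℤ.- i) ≡ ℚ.- ℤtoℚ i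
  ℤtoℚ-homo‿- i = fromℚᵘ-homo‿- (mkℚᵘ i 0)

  ℕtoℚ-homo-+ : ∀ m n → ℕtoℚ (m ℕ.+ n) ≡ ℕtoℚ m ℚ.+ ℕtoℚ n
  ℕtoℚ-homo-+ m n = ℤtoℚ-homo-+ (+ m) (+ n)

  ℕtoℚ-homo-* : ∀ m n → ℕtoℚ (m ℕ.* n) ≡ ℕtoℚ m ℚ.* ℕtoℚ n
  ℕtoℚ-homo-* m n = ≡.trans (≡.cong ℤtoℚ (ℤₚ.pos-* m n)) (ℤtoℚ-homo-* (+ m) (+ n))

  [a/n]*b≡[a*b]/n : ∀ a b n → (+ a ℚ./ suc n) ℚ.* ℕtoℚ b ≡ + (a ℕ.* b) ℚ./ suc n
  [a/n]*b≡[a*b]/n a b n = ≡.sym (≡.trans (ℚₚ.fromℚᵘ-cong {mkℚᵘ (+ (a ℕ.* b)) n} {mkℚᵘ (+ a) n ℚᵘ.* mkℚᵘ (+ b) 0} (*≡* integral))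
                                         (fromℚᵘ-homo-* (mkℚᵘ (+ a) n) (mkℚᵘ (+ b) 0)))
    where
    integral : + (a ℕ.* b) ℤ.* + (suc n ℕ.* 1) ≡ + a ℤ.* + b ℤ.* + suc n
    integral = ≡.trans (≡.cong (λ k → + (a ℕ.* b) ℤ.* + k) (ℕₚ.*-identityʳ (suc n))) (≡.cong (ℤ._* + suc n) (ℤₚ.pos-* a b))

  n*[a/n]≡a : ∀ a n → ℕtoℚ (suc n) ℚ.* (+ a ℚ./ suc n) ≡ ℕtoℚ a
  n*[a/n]≡a a n = ≡.sym (≡.trans (ℚₚ.fromℚᵘ-cong {mkℚᵘ (+ a) 0} {mkℚᵘ (+ suc n) 0 ℚᵘ.* mkℚᵘ (+ a) n} (*≡* integral))
                                 (fromℚᵘ-homo-* (mkℚᵘ (+ suc n) 0) (mkℚᵘ (+ a) n)))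
    where
    integral : + a ℤ.* + (1 ℕ.* suc n) ≡ + suc n ℤ.* + a ℤ.* + 1
    integral = ≡.trans (≡.cong (λ k → + a ℤ.* + k) (ℕₚ.*-identityˡ (suc n)))
                       (solve 2 (λ n a → a :* n := n :* a :* con (+ 1)) ≡.refl (+ suc n) (+ a))

  ℕtoℚ-suc-*-cancelˡ : ∀ n p q → ℕtoℚ (suc n) ℚ.* p ≡ ℕtoℚ (suc n) ℚ.* q → p ≡ q
  ℕtoℚ-suc-*-cancelˡ n p q eq = ≡.trans (≡.sym (cancel p)) (≡.trans (≡.cong (ℚ.1/ m ℚ.*_) eq) (cancel q))
    where
    m = ℕtoℚ (suc n)
    instance
      m≢0 : ℚ.NonZero m
      m≢0 = ℚₚ.pos⇒nonZero m {{ℚₚ.normalize-pos (suc n) 1}}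
    cancel : ∀ r → ℚ.1/ m ℚ.* (m ℚ.* r) ≡ r
    cancel r = ≡.trans (≡.sym (ℚₚ.*-assoc (ℚ.1/ m) m r)) (≡.trans (≡.cong (ℚ._* r) (ℚₚ.*-inverseˡ m)) (ℚₚ.*-identityˡ r))

open RationalCasts

record ℚ-Algebra : Set₁ where
  field
    commRing : CommutativeRing 0ℓ 0ℓ
  open CommutativeRing commRing public
  field
    emb     : ℚ → Carrier
    emb-+   : ∀ a b → emb (a ℚ.+ b) ≈ emb a + emb b
    emb-*   : ∀ a b → emb (a ℚ.* b) ≈ emb a * emb b
    emb‿-   : ∀ a → emb (ℚ.- a) ≈ - emb a
    emb-0   : emb ℚ.0ℚ ≈ 0#
    emb-1   : emb ℚ.1ℚ ≈ 1#

  fromℕ : ℕ → Carrier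
  fromℕ n = emb (ℕtoℚ n)

  fromℕ-+ : ∀ m n → fromℕ (m ℕ.+ n) ≈ fromℕ m + fromℕ n
  fromℕ-+ m n = trans (reflexive (≡.cong emb (ℕtoℚ-homo-+ m n))) (emb-+ _ _)

  fromℕ-* : ∀ m n → fromℕ (m ℕ.* n) ≈ fromℕ m * fromℕ n
  fromℕ-* m n = trans (reflexive (≡.cong emb (ℕtoℚ-homo-* m n))) (emb-* _ _)

  private
    ℤ-morphism : ℤ.+-*-rawRing -Raw-AlmostCommutative⟶ fromCommutativeRing commRing
    ℤ-morphism = record
      { ⟦_⟧    = λ i → emb (ℤtoℚ i)
      ; +-homo = λ i j → trans (reflexive (≡.cong emb (ℤtoℚ-homo-+ i j))) (emb-+ _ _)
      ; *-homo = λ i j → trans (reflexive (≡.cong emb (ℤtoℚ-homo-* i j))) (emb-* _ _)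
      ; -‿homo = λ i → trans (reflexive (≡.cong emb (ℤtoℚ-homo‿- i))) (emb‿- _)
      ; 0-homo = emb-0
      ; 1-homo = emb-1
      }

    ℤ-equal? : ∀ i j → Maybe (emb (ℤtoℚ i) ≈ emb (ℤtoℚ j))
    ℤ-equal? i j with i ℤ.≟ j
    ... | yes ≡.refl = just refl
    ... | no _       = nothing

  module Solver = Algebra.Solver.Ring ℤ.+-*-rawRing (fromCommutativeRing commRing) ℤ-morphism ℤ-equal?

ℚ-algebra : ℚ-Algebra
ℚ-algebra = record
  { commRing = ℚₚ.+-*-commutativeRing ; emb = λ q → q
  ; emb-+ = λ _ _ → ≡.refl ; emb-* = λ _ _ → ≡.refl ; emb‿- = λ _ → ≡.refl
  ; emb-0 = ≡.refl ; emb-1 = ≡.refl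
  }

series-algebra : ℚ-Algebra → ℚ-Algebra
series-algebra A = record
  { commRing = ⊕-⊛-commutativeRing
  ; emb      = λ q → const (emb q)
  ; emb-+    = λ a b → Sᵣ.trans (const-cong (emb-+ a b)) (const-+ _ _)
  ; emb-*    = λ a b → Sᵣ.trans (const-cong (emb-* a b)) (const-* _ _)
  ; emb‿-    = λ a → Sᵣ.trans (const-cong (emb‿- a)) (const‿- _)
  ; emb-0    = λ { zero → emb-0 ; (suc n) → refl }
  ; emb-1    = λ { zero → emb-1 ; (suc n) → refl }
  }
  where
  open ℚ-Algebra A
  open PowerSeries commRing

module SeriesOverℚ-Algebra (A : ℚ-Algebra) where
  open ℚ-Algebra A
  open PowerSeries commRing public
  open import Relation.Binary.Reasoning.Setoid setoid
  open import Algebra.Properties.CommutativeSemigroup *-commutativeSemigroup using (x∙yz≈y∙xz)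
  open import Algebra.Properties.Ring ring using (-‿involutive; -‿distribʳ-*)

  1+_·t : Carrier → Series
  1+ b ·t = 𝟙 ⊕ const b ⊛ t

  1+b·t⊛ : ∀ b f → 1+ b ·t ⊛ f ≋ f ⊕ const b ⊛ (t ⊛ f)
  1+b·t⊛ b f = Sᵣ.trans (Sᵣ.distribʳ f 𝟙 (const b ⊛ t)) (Sᵣ.+-cong (Sᵣ.*-identityˡ f) (Sᵣ.*-assoc (const b) t f))

  1+b·t⊛-zero : ∀ b f → (1+ b ·t ⊛ f) 0 ≈ f 0
  1+b·t⊛-zero b f = trans (1+b·t⊛ b f 0)
    (trans (+-congˡ (trans (const-⊛ b (t ⊛ f) 0) (trans (*-congˡ (t⊛-zero f)) (zeroʳ b)))) (+-identityʳ _))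

  1+b·t⊛-suc : ∀ b f k → (1+ b ·t ⊛ f) (suc k) ≈ f (suc k) + b * f k
  1+b·t⊛-suc b f k = trans (1+b·t⊛ b f (suc k)) (+-congˡ (trans (const-⊛ b (t ⊛ f) (suc k)) (*-congˡ (t⊛-suc f k))))

  binomial : ∀ b n k → (1+ b ·t ^ₛ n) k ≈ fromℕ (n C k) * b ^ k
  binomial b 0       0       = sym (trans (*-identityʳ _) emb-1)
  binomial b 0       (suc k) = sym (trans (*-congʳ emb-0) (zeroˡ _))
  binomial b (suc n) 0       = trans (1+b·t⊛-zero b (1+ b ·t ^ₛ n)) (binomial b n 0)
  binomial b (suc n) (suc k) = begin
    (1+ b ·t ^ₛ suc n) (suc k)                                      ≈⟨ 1+b·t⊛-suc b (1+ b ·t ^ₛ n) k ⟩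
    (1+ b ·t ^ₛ n) (suc k) + b * (1+ b ·t ^ₛ n) k                   ≈⟨ +-cong (binomial b n (suc k)) (*-congˡ (binomial b n k)) ⟩
    fromℕ (n C suc k) * b ^ suc k + b * (fromℕ (n C k) * b ^ k)    ≈⟨ +-congˡ (x∙yz≈y∙xz b (fromℕ (n C k)) (b ^ k)) ⟩
    fromℕ (n C suc k) * b ^ suc k + fromℕ (n C k) * b ^ suc k      ≈⟨ sym (distribʳ _ _ _) ⟩
    (fromℕ (n C suc k) + fromℕ (n C k)) * b ^ suc k                ≈⟨ *-congʳ (trans (+-comm _ _) (sym (fromℕ-+ (n C k) (n C suc k)))) ⟩
    fromℕ (n C k ℕ.+ n C suc k) * b ^ suc k                        ≡⟨ ≡.cong (λ m → fromℕ m * b ^ suc k) (nCk+nC[k+1]≡[n+1]C[k+1] n k) ⟩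
    fromℕ (suc n C suc k) * b ^ suc k                              ∎

  fromℕ-^ : ∀ m e → fromℕ m ^ e ≈ fromℕ (m ℕ.^ e)
  fromℕ-^ m zero    = sym emb-1
  fromℕ-^ m (suc e) = trans (*-congˡ (fromℕ-^ m e)) (sym (fromℕ-* m (m ℕ.^ e)))

  geometric : Carrier → Series
  geometric w k = w ^ k

  1-w·t⊛geometric : ∀ w → 1+ (- w) ·t ⊛ geometric w ≋ 𝟙
  1-w·t⊛geometric w zero    = 1+b·t⊛-zero (- w) (geometric w)
  1-w·t⊛geometric w (suc k) = trans (1+b·t⊛-suc (- w) (geometric w) k)
    (trans (sym (distribʳ _ _ _)) (trans (*-congʳ (-‿inverseʳ w)) (zeroˡ _)))

  private
    recurrence : ∀ b f g k → 1+ b ·t ⊛ f ≋ g → f (suc k) ≈ g (suc k) + - b * f k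
    recurrence b f g k bf≋g = trans (Solver.solve 3 (λ a b c → a := (a :+ b :* c) :+ :- b :* c) refl (f (suc k)) b (f k))
                                    (+-congʳ (trans (sym (1+b·t⊛-suc b f k)) (bf≋g (suc k))))
      where open Solver

  geometric^-coeff : ∀ w j k → (geometric w ^ₛ suc j) k ≈ fromℕ ((k ℕ.+ j) C j) * w ^ k
  geometric^-coeff w zero    k = trans (Sᵣ.*-identityʳ (geometric w) k) (sym (trans (*-congʳ emb-1) (*-identityˡ _)))
  geometric^-coeff w (suc j) = G-coeff
    where
    G = geometric w ^ₛ suc (suc j)
    1-w·t⊛G : 1+ (- w) ·t ⊛ G ≋ geometric w ^ₛ suc j
    1-w·t⊛G = Sᵣ.trans (Sᵣ.sym (Sᵣ.*-assoc (1+ (- w) ·t) (geometric w) (geometric w ^ₛ suc j)))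
                (Sᵣ.trans (Sᵣ.*-congʳ {geometric w ^ₛ suc j} (1-w·t⊛geometric w)) (Sᵣ.*-identityˡ (geometric w ^ₛ suc j)))
    G-coeff : ∀ k → G k ≈ fromℕ ((k ℕ.+ suc j) C suc j) * w ^ k
    G-coeff zero    = trans (sym (1+b·t⊛-zero (- w) G)) (trans (1-w·t⊛G 0) (trans (geometric^-coeff w j 0)
                        (reflexive (≡.cong (λ m → fromℕ m * 1#) (≡.trans (nCn≡1 j) (≡.sym (nCn≡1 (suc j))))))))
    G-coeff (suc k) = begin
      G (suc k)
        ≈⟨ recurrence (- w) G _ k 1-w·t⊛G ⟩
      (geometric w ^ₛ suc j) (suc k) + - - w * G k
        ≈⟨ +-cong (geometric^-coeff w j (suc k)) (*-cong (-‿involutive w) (G-coeff k)) ⟩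
      fromℕ a * w ^ suc k + w * (fromℕ b * w ^ k)
        ≈⟨ +-congˡ (x∙yz≈y∙xz w (fromℕ b) (w ^ k)) ⟩
      fromℕ a * w ^ suc k + fromℕ b * w ^ suc k
        ≈⟨ trans (sym (distribʳ _ _ _)) (*-congʳ (sym (fromℕ-+ a b))) ⟩
      fromℕ (a ℕ.+ b) * w ^ suc k
        ≡⟨ ≡.cong (λ m → fromℕ m * w ^ suc k) pascal ⟩
      fromℕ ((suc k ℕ.+ suc j) C suc j) * w ^ suc k
        ∎
      where
      a = (suc k ℕ.+ j) C j
      b = (k ℕ.+ suc j) C suc j
      pascal : a ℕ.+ b ≡ (suc k ℕ.+ suc j) C suc j
      pascal = ≡.trans (≡.cong (λ m → m C j ℕ.+ b) (≡.sym (+-suc k j))) (nCk+nC[k+1]≡[n+1]C[k+1] (k ℕ.+ suc j) j)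

  ∂ : Series → Series
  ∂ f n = fromℕ (suc n) * f (suc n)

  ∂-⊕ : ∀ f g → ∂ (f ⊕ g) ≋ ∂ f ⊕ ∂ g
  ∂-⊕ f g n = distribˡ _ _ _

  ∂-⊝ : ∀ f → ∂ (⊝ f) ≋ ⊝ ∂ f
  ∂-⊝ f n = sym (-‿distribʳ-* _ _)

  ∂-const : ∀ a → ∂ (const a) ≋ 𝟘
  ∂-const a n = zeroʳ _

  ∂-t : ∂ t ≋ 𝟙
  ∂-t zero    = trans (*-identityʳ _) emb-1
  ∂-t (suc n) = zeroʳ _

  ∂-⊛ : ∀ f g → ∂ (f ⊛ g) ≋ ∂ f ⊛ g ⊕ f ⊛ ∂ g
  ∂-⊛ f g n = begin
    fromℕ (suc n) * ∑ h (suc (suc n))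
      ≈⟨ *-distribˡ-∑ _ h (suc (suc n)) ⟩
    ∑ (λ i → fromℕ (suc n) * h i) (suc (suc n))
      ≈⟨ ∑-cong< (suc (suc n)) (λ i i<2+n → trans (*-congʳ (trans (reflexive (≡.cong fromℕ (≡.sym (m+[n∸m]≡n (≤-pred i<2+n)))))
                                                                      (fromℕ-+ i (suc n ∸ i))))
                                                  (distribʳ _ _ _)) ⟩
    ∑ (λ i → fromℕ i * h i + fromℕ (suc n ∸ i) * h i) (suc (suc n))
      ≈⟨ ∑-distrib-+ _ _ (suc (suc n)) ⟩
    ∑ (λ i → fromℕ i * h i) (suc (suc n)) + ∑ (λ i → fromℕ (suc n ∸ i) * h i) (suc (suc n))
      ≈⟨ +-cong ∂f⊛g ∂g⊛f ⟩
    (∂ f ⊛ g) n + (f ⊛ ∂ g) n ∎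
    where
    h = λ i → f i * g (suc n ∸ i)
    ∂f⊛g : ∑ (λ i → fromℕ i * h i) (suc (suc n)) ≈ (∂ f ⊛ g) n
    ∂f⊛g = trans (∑-shift _ (suc n)) (trans (+-congʳ (trans (*-congʳ emb-0) (zeroˡ (h 0)))) (trans (+-identityˡ _)
             (∑-cong (suc n) (λ i → sym (*-assoc _ _ _)))))
    ∂g⊛f : ∑ (λ i → fromℕ (suc n ∸ i) * h i) (suc (suc n)) ≈ (f ⊛ ∂ g) n
    ∂g⊛f = trans (+-congˡ (trans (*-congʳ (trans (reflexive (≡.cong fromℕ (n∸n≡0 (suc n)))) emb-0)) (zeroˡ _)))
             (trans (+-identityʳ _) (∑-cong< (suc n) (λ i i<1+n →
               trans (reflexive (≡.cong (λ m → fromℕ m * (f i * g m)) (+-∸-assoc 1 (≤-pred i<1+n)))) (x∙yz≈y∙xz _ (f i) _))))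

  private
    module ℚ⟦t⟧ = PowerSeries ℚₚ.+-*-commutativeRing

  lift : ℚ⟦t⟧.Series → Series
  lift f n = emb (f n)

  lift-∑ : ∀ f n → emb (ℚ⟦t⟧.∑ f n) ≈ ∑ (emb ∘ f) n
  lift-∑ f zero    = emb-0
  lift-∑ f (suc n) = trans (emb-+ _ _) (+-congʳ (lift-∑ f n))

  lift-quadratic : ∀ f → f ℚ⟦t⟧.≋ ℚ⟦t⟧.𝟙 ℚ⟦t⟧.⊕ ℚ⟦t⟧.t ℚ⟦t⟧.⊛ (f ℚ⟦t⟧.⊛ f) → lift f ≋ 𝟙 ⊕ t ⊛ (lift f ⊛ lift f)
  lift-quadratic f f≋ zero    = trans (reflexive (≡.cong emb (f≋ 0)))
    (trans (emb-+ _ _) (+-cong emb-1 (trans (reflexive (≡.cong emb (ℚ⟦t⟧.t⊛-zero (f ℚ⟦t⟧.⊛ f)))) (trans emb-0 (sym (t⊛-zero (lift f ⊛ lift f)))))))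
  lift-quadratic f f≋ (suc n) = trans (reflexive (≡.cong emb (f≋ (suc n))))
    (trans (emb-+ _ _) (+-cong emb-0 (trans (reflexive (≡.cong emb (ℚ⟦t⟧.t⊛-suc (f ℚ⟦t⟧.⊛ f) n)))
      (trans (lift-∑ _ (suc n)) (trans (∑-cong (suc n) (λ i → emb-* _ _)) (sym (t⊛-suc (lift f ⊛ lift f) n)))))))

module BinomialIdentities where
  open import Data.Nat
  open import Data.Nat.Properties
  open import Data.Nat.Combinatorics using (nCk≡n!/k![n-k]!; k![n∸k]!∣n!)
  open import Data.Nat.DivMod using (m/n*n≡m)
  open import Data.Nat.Solver using (module +-*-Solver)
  open +-*-Solver
  open ≡ using (cong; sym; trans)
  open ≡.≡-Reasoning

  nCk*[k!*[n∸k]!]≡n! : ∀ {n k} → k ≤ n → (n C k) * (k ! * (n ∸ k) !) ≡ n !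
  nCk*[k!*[n∸k]!]≡n! {n} {k} k≤n =
    trans (cong (_* (k ! * (n ∸ k) !)) (nCk≡n!/k![n-k]! k≤n)) (m/n*n≡m {{k !* (n ∸ k) !≢0}} (k![n∸k]!∣n! k≤n))

  [1+n]*[2+2n]C[1+n]≡2*[1+2n]*[2n]Cn : ∀ n → suc n * ((suc n + suc n) C suc n) ≡ 2 * suc (n + n) * ((n + n) C n)
  [1+n]*[2+2n]C[1+n]≡2*[1+2n]*[2n]Cn n = *-cancelʳ-≡ _ _ (suc n * (f * f)) {{m*n≢0 (suc n) (f * f) {{_}} {{n !* n !≢0}}}} (begin
    suc n * a * (suc n * (f * f))                      ≡⟨ solve 3 (λ n a f → (con 1 :+ n) :* a :* ((con 1 :+ n) :* (f :* f))
                                                                         := a :* (((con 1 :+ n) :* f) :* ((con 1 :+ n) :* f))) ≡.refl n a f ⟩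
    a * (suc n ! * suc n !)                            ≡⟨ cong (λ m → a * (suc n ! * m !)) (sym (m+n∸m≡n (suc n) (suc n))) ⟩
    a * (suc n ! * (suc n + suc n ∸ suc n) !)          ≡⟨ nCk*[k!*[n∸k]!]≡n! (m≤m+n (suc n) (suc n)) ⟩
    (suc n + suc n) !                                  ≡⟨ cong _! (+-suc (suc n) n) ⟩
    suc (suc (n + n)) * (suc (n + n) * (n + n) !)      ≡⟨ cong (λ m → suc (suc (n + n)) * (suc (n + n) * m)) (sym b*f*f≡[2n]!) ⟩
    suc (suc (n + n)) * (suc (n + n) * (b * (f * f)))  ≡⟨ solve 3 (λ n b f → (con 2 :+ (n :+ n)) :* ((con 1 :+ (n :+ n)) :* (b :* (f :* f)))
                                                                         := con 2 :* (con 1 :+ (n :+ n)) :* b :* ((con 1 :+ n) :* (f :* f))) ≡.refl n b f ⟩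
    2 * suc (n + n) * b * (suc n * (f * f))            ∎)
    where
    a = (suc n + suc n) C suc n
    b = (n + n) C n
    f = n !
    b*f*f≡[2n]! : b * (f * f) ≡ (n + n) !
    b*f*f≡[2n]! = trans (cong (λ m → b * (f * m !)) (sym (m+n∸m≡n n n))) (nCk*[k!*[n∸k]!]≡n! (m≤m+n n n))

  [n+m]Cm*[n+n]C[n+m]≡[n+n]Cn*nCm : ∀ n m → m ≤ n → ((n + m) C m) * ((n + n) C (n + m)) ≡ ((n + n) C n) * (n C m)
  [n+m]Cm*[n+n]C[n+m]≡[n+n]Cn*nCm n m m≤n = *-cancelʳ-≡ _ _ (u * v * w) {{m*n≢0 (u * v) w {{m !* n !≢0}} {{(n ∸ m) !≢0}}}} (begin
    A * B * (u * v * w)        ≡⟨ solve 5 (λ A B u v w → A :* B :* (u :* v :* w) := B :* ((A :* (u :* v)) :* w)) ≡.refl A B u v w ⟩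
    B * ((A * (u * v)) * w)    ≡⟨ cong (λ z → B * (z * w)) A*u*v≡[n+m]! ⟩
    B * ((n + m) ! * w)        ≡⟨ B*[n+m]!*w≡[n+n]! ⟩
    (n + n) !                  ≡⟨ sym Cₙ*v*v≡[n+n]! ⟩
    Cₙ * (v * v)               ≡⟨ cong (λ z → Cₙ * (z * v)) (sym (nCk*[k!*[n∸k]!]≡n! m≤n)) ⟩
    Cₙ * (D * (u * w) * v)     ≡⟨ solve 5 (λ C D u v w → C :* (D :* (u :* w) :* v) := C :* D :* (u :* v :* w)) ≡.refl Cₙ D u v w ⟩
    Cₙ * D * (u * v * w)       ∎)
    where
    A = (n + m) C m
    B = (n + n) C (n + m)
    Cₙ = (n + n) C n
    D = n C m
    u = m !
    v = n !
    w = (n ∸ m) !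
    A*u*v≡[n+m]! : A * (u * v) ≡ (n + m) !
    A*u*v≡[n+m]! = trans (cong (λ z → A * (u * z !)) (sym (trans (cong (_∸ m) (+-comm n m)) (m+n∸m≡n m n))))
                         (nCk*[k!*[n∸k]!]≡n! (m≤n+m m n))
    B*[n+m]!*w≡[n+n]! : B * ((n + m) ! * w) ≡ (n + n) !
    B*[n+m]!*w≡[n+n]! = trans (cong (λ z → B * ((n + m) ! * z !)) (sym ([m+n]∸[m+o]≡n∸o n n m)))
                              (nCk*[k!*[n∸k]!]≡n! (+-monoʳ-≤ n m≤n))
    Cₙ*v*v≡[n+n]! : Cₙ * (v * v) ≡ (n + n) !
    Cₙ*v*v≡[n+n]! = trans (cong (λ z → Cₙ * (v * z !)) (sym (m+n∸m≡n n n))) (nCk*[k!*[n∸k]!]≡n! (m≤m+n n n))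

module Halving where
  open import Data.Nat
  open import Data.Nat.Properties
  open import Data.Nat.DivMod using (m/n*n≤m; m*n/n≡m; /-monoˡ-≤)

  private
    m+m≡m*2 : ∀ m → m + m ≡ m * 2
    m+m≡m*2 m = ≡.trans (≡.cong (λ k → m + k) (≡.sym (*-identityʳ m))) (≡.sym (*-suc m 1))

  m≤n/2⇒m+m≤n : ∀ {m n} → m ≤ n / 2 → m + m ≤ n
  m≤n/2⇒m+m≤n {m} {n} m≤n/2 = ≤-trans (≤-reflexive (m+m≡m*2 m)) (≤-trans (*-monoˡ-≤ 2 m≤n/2) (m/n*n≤m n 2))

  n/2<m⇒n<m+m : ∀ {m n} → n / 2 < m → n < m + m
  n/2<m⇒n<m+m {m} {n} n/2<m = ≰⇒> (λ m+m≤n → <⇒≱ n/2<m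
    (≤-trans (≤-reflexive (≡.sym (≡.trans (≡.cong (_/ 2) (m+m≡m*2 m)) (m*n/n≡m m 2)))) (/-monoˡ-≤ 2 m+m≤n)))

module Catalan where
  open SeriesOverℚ-Algebra ℚ-algebra
  open BinomialIdentities using ([1+n]*[2+2n]C[1+n]≡2*[1+2n]*[2n]Cn)
  private
    module ℚ⟦t⟧ = ℚ-Algebra (series-algebra ℚ-algebra)
    module ℚ-Solver = ℚ-Algebra.Solver ℚ-algebra
    module ℕ-Solver = Data.Nat.Solver.+-*-Solver

  catalan : ℕ → ℚ
  catalan n = + ((n ℕ.+ n) C n) ℚ./ suc n

  catalan-suc : ∀ n → ℕtoℚ (suc (suc n)) ℚ.* catalan (suc n) ≡ ℕtoℚ (2 ℕ.* suc (n ℕ.+ n)) ℚ.* catalan n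
  catalan-suc n = ℕtoℚ-suc-*-cancelˡ n _ _ (begin
    ℕtoℚ (suc n) ℚ.* (ℕtoℚ (suc (suc n)) ℚ.* catalan (suc n))  ≡⟨ ≡.cong (ℕtoℚ (suc n) ℚ.*_) (n*[a/n]≡a a (suc n)) ⟩
    ℕtoℚ (suc n) ℚ.* ℕtoℚ a                                    ≡⟨ ≡.sym (ℕtoℚ-homo-* (suc n) a) ⟩
    ℕtoℚ (suc n ℕ.* a)                                         ≡⟨ ≡.cong ℕtoℚ ([1+n]*[2+2n]C[1+n]≡2*[1+2n]*[2n]Cn n) ⟩
    ℕtoℚ (m ℕ.* b)                                             ≡⟨ ℕtoℚ-homo-* m b ⟩
    ℕtoℚ m ℚ.* ℕtoℚ b                                          ≡⟨ ≡.cong (ℕtoℚ m ℚ.*_) (≡.sym (n*[a/n]≡a b n)) ⟩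
    ℕtoℚ m ℚ.* (ℕtoℚ (suc n) ℚ.* catalan n)                    ≡⟨ x∙yz≈y∙xz (ℕtoℚ m) (ℕtoℚ (suc n)) (catalan n) ⟩
    ℕtoℚ (suc n) ℚ.* (ℕtoℚ m ℚ.* catalan n)                    ∎)
    where
    open ≡.≡-Reasoning
    open import Algebra.Properties.CommutativeSemigroup (CommutativeRing.*-commutativeSemigroup ℚₚ.+-*-commutativeRing) using (x∙yz≈y∙xz)
    a = (suc n ℕ.+ suc n) C suc n
    b = (n ℕ.+ n) C n
    m = 2 ℕ.* suc (n ℕ.+ n)

  κ : ℕ → Series
  κ = ℚ⟦t⟧.fromℕ

  private
    2*[3+2k]≡6+4k : ∀ k → 2 ℕ.* suc (suc k ℕ.+ suc k) ≡ 6 ℕ.+ 4 ℕ.* k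
    2*[3+2k]≡6+4k = solve 1 (λ k → con 2 :* (con 1 :+ ((con 1 :+ k) :+ (con 1 :+ k))) := con 6 :+ con 4 :* k) ≡.refl
      where open ℕ-Solver

  -- (1 - 4t) t C′ = 1 - C + 2tC, which is catalan-suc read coefficientwise.
  catalan-ode : t ⊛ ∂ catalan ⊕ ⊝ (κ 4 ⊛ (t ⊛ (t ⊛ ∂ catalan))) ≋ 𝟙 ⊕ ⊝ catalan ⊕ κ 2 ⊛ (t ⊛ catalan)
  catalan-ode n = ≡.trans (≡.cong (λ x → (t ⊛ ∂ catalan) n ℚ.+ ℚ.- x) (const-⊛ (ℕtoℚ 4) (t ⊛ (t ⊛ ∂ catalan)) n))
                 (≡.trans (coefficients n) (≡.cong (𝟙 n ℚ.+ ℚ.- catalan n ℚ.+_) (≡.sym (const-⊛ (ℕtoℚ 2) (t ⊛ catalan) n))))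
    where
    open ≡.≡-Reasoning
    open ℚ-Solver
    coefficients : ∀ n → (t ⊛ ∂ catalan) n ℚ.+ ℚ.- (ℕtoℚ 4 ℚ.* (t ⊛ (t ⊛ ∂ catalan)) n)
                         ≡ 𝟙 n ℚ.+ ℚ.- catalan n ℚ.+ ℕtoℚ 2 ℚ.* (t ⊛ catalan) n
    coefficients zero = ≡.trans
      (≡.cong₂ (λ x y → x ℚ.+ ℚ.- (ℕtoℚ 4 ℚ.* y)) (t⊛-zero (∂ catalan)) (t⊛-zero (t ⊛ ∂ catalan)))
      (≡.cong (λ y → ℚ.1ℚ ℚ.+ ℚ.- ℚ.1ℚ ℚ.+ ℕtoℚ 2 ℚ.* y) (≡.sym (t⊛-zero catalan)))
    coefficients (suc zero) = ≡.trans
      (≡.cong₂ (λ x y → x ℚ.+ ℚ.- (ℕtoℚ 4 ℚ.* y)) (t⊛-suc (∂ catalan) 0) (≡.trans (t⊛-suc (t ⊛ ∂ catalan) 0) (t⊛-zero (∂ catalan))))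
      (≡.cong (λ y → ℚ.0ℚ ℚ.+ ℚ.- ℚ.1ℚ ℚ.+ ℕtoℚ 2 ℚ.* y) (≡.sym (t⊛-suc catalan 0)))
    coefficients (suc (suc k)) = begin
      (t ⊛ ∂ catalan) (2 ℕ.+ k) ℚ.+ ℚ.- (ℕtoℚ 4 ℚ.* (t ⊛ (t ⊛ ∂ catalan)) (2 ℕ.+ k))
        ≡⟨ ≡.cong₂ (λ x y → x ℚ.+ ℚ.- (ℕtoℚ 4 ℚ.* y)) (t⊛-suc (∂ catalan) (suc k))
                   (≡.trans (t⊛-suc (t ⊛ ∂ catalan) (suc k)) (t⊛-suc (∂ catalan) k)) ⟩
      ℕtoℚ (2 ℕ.+ k) ℚ.* c₂ ℚ.+ ℚ.- (ℕtoℚ 4 ℚ.* (ℕtoℚ (1 ℕ.+ k) ℚ.* c₁))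
        ≡⟨ ≡.cong₂ (λ x y → x ℚ.* c₂ ℚ.+ ℚ.- (ℕtoℚ 4 ℚ.* (y ℚ.* c₁))) (ℕtoℚ-homo-+ 2 k) (ℕtoℚ-homo-+ 1 k) ⟩
      (ℕtoℚ 2 ℚ.+ a) ℚ.* c₂ ℚ.+ ℚ.- (ℕtoℚ 4 ℚ.* ((ℕtoℚ 1 ℚ.+ a) ℚ.* c₁))
        ≡⟨ solve 3 (λ a c₁ c₂ → (con (+ 2) :+ a) :* c₂ :+ :- (con (+ 4) :* ((con (+ 1) :+ a) :* c₁))
                             := (con (+ 3) :+ a) :* c₂ :- (con (+ 6) :+ con (+ 4) :* a) :* c₁ :+ (:- c₂ :+ con (+ 2) :* c₁))
                   ≡.refl a c₁ c₂ ⟩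
      (ℕtoℚ 3 ℚ.+ a) ℚ.* c₂ ℚ.- (ℕtoℚ 6 ℚ.+ ℕtoℚ 4 ℚ.* a) ℚ.* c₁ ℚ.+ (ℚ.- c₂ ℚ.+ ℕtoℚ 2 ℚ.* c₁)
        ≡⟨ ≡.cong (λ x → x ℚ.- (ℕtoℚ 6 ℚ.+ ℕtoℚ 4 ℚ.* a) ℚ.* c₁ ℚ.+ (ℚ.- c₂ ℚ.+ ℕtoℚ 2 ℚ.* c₁)) step ⟩
      (ℕtoℚ 6 ℚ.+ ℕtoℚ 4 ℚ.* a) ℚ.* c₁ ℚ.- (ℕtoℚ 6 ℚ.+ ℕtoℚ 4 ℚ.* a) ℚ.* c₁ ℚ.+ (ℚ.- c₂ ℚ.+ ℕtoℚ 2 ℚ.* c₁)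
        ≡⟨ solve 3 (λ x c₁ c₂ → x :- x :+ (:- c₂ :+ con (+ 2) :* c₁) := con (+ 0) :+ :- c₂ :+ con (+ 2) :* c₁)
                   ≡.refl ((ℕtoℚ 6 ℚ.+ ℕtoℚ 4 ℚ.* a) ℚ.* c₁) c₁ c₂ ⟩
      ℚ.0ℚ ℚ.+ ℚ.- c₂ ℚ.+ ℕtoℚ 2 ℚ.* c₁
        ≡⟨ ≡.cong (λ y → ℚ.0ℚ ℚ.+ ℚ.- c₂ ℚ.+ ℕtoℚ 2 ℚ.* y) (≡.sym (t⊛-suc catalan (suc k))) ⟩
      𝟙 (2 ℕ.+ k) ℚ.+ ℚ.- catalan (2 ℕ.+ k) ℚ.+ ℕtoℚ 2 ℚ.* (t ⊛ catalan) (2 ℕ.+ k) ∎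
      where
      a = ℕtoℚ k
      c₁ = catalan (suc k)
      c₂ = catalan (suc (suc k))
      step : (ℕtoℚ 3 ℚ.+ a) ℚ.* c₂ ≡ (ℕtoℚ 6 ℚ.+ ℕtoℚ 4 ℚ.* a) ℚ.* c₁
      step = begin
        (ℕtoℚ 3 ℚ.+ a) ℚ.* c₂                   ≡⟨ ≡.cong (ℚ._* c₂) (≡.sym (ℕtoℚ-homo-+ 3 k)) ⟩
        ℕtoℚ (3 ℕ.+ k) ℚ.* c₂                   ≡⟨ catalan-suc (suc k) ⟩
        ℕtoℚ (2 ℕ.* suc (suc k ℕ.+ suc k)) ℚ.* c₁ ≡⟨ ≡.cong (λ m → ℕtoℚ m ℚ.* c₁) (2*[3+2k]≡6+4k k) ⟩
        ℕtoℚ (6 ℕ.+ 4 ℕ.* k) ℚ.* c₁             ≡⟨ ≡.cong (ℚ._* c₁) (≡.trans (ℕtoℚ-homo-+ 6 (4 ℕ.* k)) (≡.cong (ℕtoℚ 6 ℚ.+_) (ℕtoℚ-homo-* 4 k))) ⟩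
        (ℕtoℚ 6 ℚ.+ ℕtoℚ 4 ℚ.* a) ℚ.* c₁        ∎

  -- (1 - 4t) F′ = -4F together with F(0) = 1 forces F = 1 - 4t.
  private
    E F : Series
    E = 𝟙 ⊕ ⊝ (κ 2 ⊛ (t ⊛ catalan))
    F = E ⊛ E

    ∂E : ∂ E ≋ ⊝ (κ 2 ⊛ (catalan ⊕ t ⊛ ∂ catalan))
    ∂E = begin
      ∂ (𝟙 ⊕ ⊝ (κ 2 ⊛ (t ⊛ catalan)))
        ≈⟨ Sᵣ.trans (∂-⊕ 𝟙 (⊝ (κ 2 ⊛ (t ⊛ catalan)))) (Sᵣ.+-cong (∂-const ℚ.1ℚ) (∂-⊝ (κ 2 ⊛ (t ⊛ catalan)))) ⟩
      𝟘 ⊕ ⊝ ∂ (κ 2 ⊛ (t ⊛ catalan))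
        ≈⟨ Sᵣ.trans (Sᵣ.+-identityˡ _) (Sᵣ.-‿cong (∂-⊛ (κ 2) (t ⊛ catalan))) ⟩
      ⊝ (∂ (κ 2) ⊛ (t ⊛ catalan) ⊕ κ 2 ⊛ ∂ (t ⊛ catalan))
        ≈⟨ Sᵣ.-‿cong (Sᵣ.+-cong (Sᵣ.*-congʳ {t ⊛ catalan} (∂-const (ℕtoℚ 2))) (Sᵣ.*-congˡ {κ 2} (∂-⊛ t catalan))) ⟩
      ⊝ (𝟘 ⊛ (t ⊛ catalan) ⊕ κ 2 ⊛ (∂ t ⊛ catalan ⊕ t ⊛ ∂ catalan))
        ≈⟨ Sᵣ.-‿cong (Sᵣ.+-cong (Sᵣ.zeroˡ (t ⊛ catalan))
                                (Sᵣ.*-congˡ {κ 2} (Sᵣ.+-congʳ {t ⊛ ∂ catalan} (Sᵣ.trans (Sᵣ.*-congʳ {catalan} ∂-t) (Sᵣ.*-identityˡ catalan))))) ⟩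
      ⊝ (𝟘 ⊕ κ 2 ⊛ (catalan ⊕ t ⊛ ∂ catalan))
        ≈⟨ Sᵣ.-‿cong (Sᵣ.+-identityˡ _) ⟩
      ⊝ (κ 2 ⊛ (catalan ⊕ t ⊛ ∂ catalan))
        ∎
      where open import Relation.Binary.Reasoning.Setoid ℚ⟦t⟧.setoid

    F-ode : (𝟙 ⊕ ⊝ (κ 4 ⊛ t)) ⊛ ∂ F ≋ ⊝ (κ 4 ⊛ F)
    F-ode = begin
      (𝟙 ⊕ ⊝ (κ 4 ⊛ t)) ⊛ ∂ F
        ≈⟨ Sᵣ.*-congˡ {𝟙 ⊕ ⊝ (κ 4 ⊛ t)} (Sᵣ.trans (∂-⊛ E E) (Sᵣ.+-cong (Sᵣ.*-congʳ {E} ∂E) (Sᵣ.*-congˡ {E} ∂E))) ⟩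
      (𝟙 ⊕ ⊝ (κ 4 ⊛ t)) ⊛ (D ⊛ E ⊕ E ⊛ D)
        ≈⟨ solve 3 (λ t c c′ → (con (+ 1) :+ :- (con (+ 4) :* t)) :* (D′ t c c′ :* E′ t c :+ E′ t c :* D′ t c c′)
                            := :- (con (+ 4) :* E′ t c) :* ((con (+ 1) :+ :- (con (+ 4) :* t)) :* c)
                               :+ :- (con (+ 4) :* E′ t c) :* (t :* c′ :+ :- (con (+ 4) :* (t :* (t :* c′)))))
                   Sᵣ.refl t catalan (∂ catalan) ⟩
      ⊝ (κ 4 ⊛ E) ⊛ ((𝟙 ⊕ ⊝ (κ 4 ⊛ t)) ⊛ catalan) ⊕ ⊝ (κ 4 ⊛ E) ⊛ (t ⊛ ∂ catalan ⊕ ⊝ (κ 4 ⊛ (t ⊛ (t ⊛ ∂ catalan))))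
        ≈⟨ Sᵣ.+-congˡ {⊝ (κ 4 ⊛ E) ⊛ ((𝟙 ⊕ ⊝ (κ 4 ⊛ t)) ⊛ catalan)} (Sᵣ.*-congˡ {⊝ (κ 4 ⊛ E)} catalan-ode) ⟩
      ⊝ (κ 4 ⊛ E) ⊛ ((𝟙 ⊕ ⊝ (κ 4 ⊛ t)) ⊛ catalan) ⊕ ⊝ (κ 4 ⊛ E) ⊛ (𝟙 ⊕ ⊝ catalan ⊕ κ 2 ⊛ (t ⊛ catalan))
        ≈⟨ solve 2 (λ t c → :- (con (+ 4) :* E′ t c) :* ((con (+ 1) :+ :- (con (+ 4) :* t)) :* c)
                            :+ :- (con (+ 4) :* E′ t c) :* (con (+ 1) :+ :- c :+ con (+ 2) :* (t :* c))
                          := :- (con (+ 4) :* (E′ t c :* E′ t c)))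
                   Sᵣ.refl t catalan ⟩
      ⊝ (κ 4 ⊛ F) ∎
      where
      open import Relation.Binary.Reasoning.Setoid ℚ⟦t⟧.setoid
      open ℚ⟦t⟧.Solver
      D = ⊝ (κ 2 ⊛ (catalan ⊕ t ⊛ ∂ catalan))
      E′ = λ {n} (t c : Polynomial n) → con (+ 1) :+ :- (con (+ 2) :* (t :* c))
      D′ = λ {n} (t c c′ : Polynomial n) → :- (con (+ 2) :* (c :+ t :* c′))

    F-recurrence : ∀ n → ℕtoℚ (suc n) ℚ.* F (suc n) ℚ.+ ℚ.- (ℕtoℚ 4 ℚ.* (t ⊛ ∂ F) n) ≡ ℚ.- (ℕtoℚ 4 ℚ.* F n)
    F-recurrence n = begin
      ∂ F n ℚ.+ ℚ.- (ℕtoℚ 4 ℚ.* (t ⊛ ∂ F) n)   ≡⟨ ≡.cong (λ x → ∂ F n ℚ.+ ℚ.- x) (≡.sym (const-⊛ (ℕtoℚ 4) (t ⊛ ∂ F) n)) ⟩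
      (∂ F ⊕ ⊝ (κ 4 ⊛ (t ⊛ ∂ F))) n           ≡⟨ solve 2 (λ t f → f :+ :- (con (+ 4) :* (t :* f)) := (con (+ 1) :+ :- (con (+ 4) :* t)) :* f)
                                                         Sᵣ.refl t (∂ F) n ⟩
      ((𝟙 ⊕ ⊝ (κ 4 ⊛ t)) ⊛ ∂ F) n           ≡⟨ F-ode n ⟩
      ℚ.- (κ 4 ⊛ F) n                          ≡⟨ ≡.cong ℚ.-_ (const-⊛ (ℕtoℚ 4) F n) ⟩
      ℚ.- (ℕtoℚ 4 ℚ.* F n)                     ∎
      where
      open ≡.≡-Reasoning
      open ℚ⟦t⟧.Solver

    F-zero : F 0 ≡ ℚ.1ℚ
    F-zero = ≡.cong (λ x → ℚ.0ℚ ℚ.+ (ℚ.1ℚ ℚ.+ ℚ.- x) ℚ.* (ℚ.1ℚ ℚ.+ ℚ.- x))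
                    (≡.trans (const-⊛ (ℕtoℚ 2) (t ⊛ catalan) 0) (≡.cong (ℕtoℚ 2 ℚ.*_) (t⊛-zero catalan)))

    F-one : F 1 ≡ ℚ.- ℕtoℚ 4
    F-one = begin
      F 1                                                ≡⟨ solve 1 (λ x → x := x :+ :- (con (+ 4) :* con (+ 0))) ≡.refl (F 1) ⟩
      ℕtoℚ 1 ℚ.* F 1 ℚ.+ ℚ.- (ℕtoℚ 4 ℚ.* ℚ.0ℚ)          ≡⟨ ≡.cong (λ x → ℕtoℚ 1 ℚ.* F 1 ℚ.+ ℚ.- (ℕtoℚ 4 ℚ.* x)) (≡.sym (t⊛-zero (∂ F))) ⟩
      ℕtoℚ 1 ℚ.* F 1 ℚ.+ ℚ.- (ℕtoℚ 4 ℚ.* (t ⊛ ∂ F) 0)   ≡⟨ F-recurrence 0 ⟩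
      ℚ.- (ℕtoℚ 4 ℚ.* F 0)                               ≡⟨ ≡.cong (λ x → ℚ.- (ℕtoℚ 4 ℚ.* x)) F-zero ⟩
      ℚ.- ℕtoℚ 4                                         ∎
      where
      open ≡.≡-Reasoning
      open ℚ-Solver

    F-suc-suc : ∀ k → ℕtoℚ (2 ℕ.+ k) ℚ.* F (2 ℕ.+ k) ≡ ℕtoℚ 4 ℚ.* (ℕtoℚ k ℚ.* F (suc k))
    F-suc-suc k = begin
      u                                             ≡⟨ solve 2 (λ u v → u := (u :+ :- (con (+ 4) :* v)) :+ con (+ 4) :* v) ≡.refl u v ⟩
      u ℚ.+ ℚ.- (ℕtoℚ 4 ℚ.* v) ℚ.+ ℕtoℚ 4 ℚ.* v      ≡⟨ ≡.cong (λ z → u ℚ.+ ℚ.- (ℕtoℚ 4 ℚ.* z) ℚ.+ ℕtoℚ 4 ℚ.* v) v≡ ⟩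
      u ℚ.+ ℚ.- (ℕtoℚ 4 ℚ.* (t ⊛ ∂ F) (suc k)) ℚ.+ ℕtoℚ 4 ℚ.* v
                                                    ≡⟨ ≡.cong (ℚ._+ ℕtoℚ 4 ℚ.* v) (F-recurrence (suc k)) ⟩
      ℚ.- (ℕtoℚ 4 ℚ.* F (suc k)) ℚ.+ ℕtoℚ 4 ℚ.* v    ≡⟨ solve 2 (λ a f → :- (con (+ 4) :* f) :+ con (+ 4) :* ((con (+ 1) :+ a) :* f)
                                                                := con (+ 4) :* (a :* f)) ≡.refl (ℕtoℚ k) (F (suc k)) ⟩
      ℕtoℚ 4 ℚ.* (ℕtoℚ k ℚ.* F (suc k))             ∎
      where
      open ≡.≡-Reasoning
      open ℚ-Solver
      u = ℕtoℚ (2 ℕ.+ k) ℚ.* F (2 ℕ.+ k)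
      v = (ℕtoℚ 1 ℚ.+ ℕtoℚ k) ℚ.* F (suc k)
      v≡ : v ≡ (t ⊛ ∂ F) (suc k)
      v≡ = ≡.trans (≡.cong (ℚ._* F (suc k)) (≡.sym (ℕtoℚ-homo-+ 1 k))) (≡.sym (t⊛-suc (∂ F) k))

    F-suc-suc-zero : ∀ k → F (2 ℕ.+ k) ≡ ℚ.0ℚ
    F-suc-suc-zero k = ℕtoℚ-suc-*-cancelˡ (suc k) _ _ (≡.trans (F-suc-suc k) (≡.trans (vanish k) (≡.sym (ℚₚ.*-zeroʳ (ℕtoℚ (2 ℕ.+ k))))))
      where
      vanish : ∀ k → ℕtoℚ 4 ℚ.* (ℕtoℚ k ℚ.* F (suc k)) ≡ ℚ.0ℚ
      vanish zero    = ≡.trans (≡.cong (ℕtoℚ 4 ℚ.*_) (ℚₚ.*-zeroˡ (F 1))) (ℚₚ.*-zeroʳ (ℕtoℚ 4))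
      vanish (suc k) = ≡.trans (≡.cong (λ x → ℕtoℚ 4 ℚ.* (ℕtoℚ (suc k) ℚ.* x)) (F-suc-suc-zero k))
                               (≡.trans (≡.cong (ℕtoℚ 4 ℚ.*_) (ℚₚ.*-zeroʳ (ℕtoℚ (suc k)))) (ℚₚ.*-zeroʳ (ℕtoℚ 4)))

    F≋1-4t : F ≋ 𝟙 ⊕ ⊝ (κ 4 ⊛ t)
    F≋1-4t zero                = ≡.trans F-zero (≡.sym (≡.cong (λ x → ℚ.1ℚ ℚ.+ ℚ.- x) (const-⊛ (ℕtoℚ 4) t 0)))
    F≋1-4t (suc zero)          = ≡.trans F-one (≡.sym (≡.cong (λ x → ℚ.0ℚ ℚ.+ ℚ.- x) (const-⊛ (ℕtoℚ 4) t 1)))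
    F≋1-4t (suc (suc k))       = ≡.trans (F-suc-suc-zero k) (≡.sym (≡.cong (λ x → ℚ.0ℚ ℚ.+ ℚ.- x) (const-⊛ (ℕtoℚ 4) t (2 ℕ.+ k))))

  catalan-equation : catalan ≋ 𝟙 ⊕ t ⊛ (catalan ⊛ catalan)
  catalan-equation = begin
    catalan                                   ≈⟨ solve 2 (λ t c → c := κ1+tc² t c :+ :- W′ t c) Sᵣ.refl t catalan ⟩
    𝟙 ⊕ t ⊛ (catalan ⊛ catalan) ⊕ ⊝ W      ≈⟨ Sᵣ.+-congˡ {𝟙 ⊕ t ⊛ (catalan ⊛ catalan)} (Sᵣ.-‿cong W≋0) ⟩
    𝟙 ⊕ t ⊛ (catalan ⊛ catalan) ⊕ ⊝ 𝟘      ≈⟨ Sᵣ.trans (Sᵣ.+-congˡ {𝟙 ⊕ t ⊛ (catalan ⊛ catalan)} -0#≈0#) (Sᵣ.+-identityʳ _) ⟩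
    𝟙 ⊕ t ⊛ (catalan ⊛ catalan)              ∎
    where
    open import Relation.Binary.Reasoning.Setoid ℚ⟦t⟧.setoid
    open import Algebra.Properties.Ring ℚ⟦t⟧.ring using (-0#≈0#)
    open ℚ⟦t⟧.Solver
    κ1+tc² W′ : ∀ {n} → Polynomial n → Polynomial n → Polynomial n
    κ1+tc² t c = con (+ 1) :+ t :* (c :* c)
    W′ t c = κ1+tc² t c :+ :- c
    W = 𝟙 ⊕ t ⊛ (catalan ⊛ catalan) ⊕ ⊝ catalan
    4tW≋0 : κ 4 ⊛ (t ⊛ W) ≋ 𝟘
    4tW≋0 = begin
      κ 4 ⊛ (t ⊛ W)                 ≈⟨ solve 2 (λ t c → con (+ 4) :* (t :* W′ t c)
                                                 := (con (+ 1) :+ :- (con (+ 2) :* (t :* c))) :* (con (+ 1) :+ :- (con (+ 2) :* (t :* c)))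
                                                    :+ :- (con (+ 1) :+ :- (con (+ 4) :* t))) Sᵣ.refl t catalan ⟩
      F ⊕ ⊝ (𝟙 ⊕ ⊝ (κ 4 ⊛ t))      ≈⟨ Sᵣ.+-congʳ F≋1-4t ⟩
      (𝟙 ⊕ ⊝ (κ 4 ⊛ t)) ⊕ ⊝ (𝟙 ⊕ ⊝ (κ 4 ⊛ t))  ≈⟨ Sᵣ.-‿inverseʳ (𝟙 ⊕ ⊝ (κ 4 ⊛ t)) ⟩
      𝟘                              ∎
    W≋0 : W ≋ 𝟘
    W≋0 = t⊛-cancel (λ n → ≡.trans (ℕtoℚ-suc-*-cancelˡ 3 _ _ (≡.trans (≡.sym (const-⊛ (ℕtoℚ 4) (t ⊛ W) n))
                                                                     (≡.trans (4tW≋0 n) (≡.sym (ℚₚ.*-zeroʳ (ℕtoℚ 4))))))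
                                  (≡.sym (Sᵣ.zeroʳ t n)))

module PolynomialCoefficients where
  open SeriesOverℚ-Algebra ℚ-algebra

  coeff-addP : ∀ p q n → coeff (addP p q) n ≡ coeff p n ℚ.+ coeff q n
  coeff-addP []      q       n       = ≡.sym (ℚₚ.+-identityˡ _)
  coeff-addP (a ∷ p) []      n       = ≡.sym (ℚₚ.+-identityʳ _)
  coeff-addP (a ∷ p) (b ∷ q) zero    = ≡.refl
  coeff-addP (a ∷ p) (b ∷ q) (suc n) = coeff-addP p q n

  coeff-scaleP : ∀ c p n → coeff (scaleP c p) n ≡ c ℚ.* coeff p n
  coeff-scaleP c []      n       = ≡.sym (ℚₚ.*-zeroʳ c)
  coeff-scaleP c (a ∷ p) zero    = ≡.refl
  coeff-scaleP c (a ∷ p) (suc n) = coeff-scaleP c p n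

  coeff-mulP : ∀ p q → coeff (mulP p q) ≋ coeff p ⊛ coeff q
  coeff-mulP []      q n       = ≡.sym (∑-zero (suc n) (λ i _ → ℚₚ.*-zeroˡ (coeff q (n ∸ i))))
  coeff-mulP (a ∷ p) q zero    = ≡.trans (coeff-addP (scaleP a q) (ℚ.0ℚ ∷ mulP p q) 0)
    (≡.trans (≡.cong (ℚ._+ ℚ.0ℚ) (coeff-scaleP a q 0)) (≡.trans (ℚₚ.+-identityʳ (a ℚ.* coeff q 0)) (≡.sym (ℚₚ.+-identityˡ (a ℚ.* coeff q 0)))))
  coeff-mulP (a ∷ p) q (suc n) = ≡.trans (coeff-addP (scaleP a q) (ℚ.0ℚ ∷ mulP p q) (suc n))
    (≡.trans (≡.cong₂ ℚ._+_ (coeff-scaleP a q (suc n)) (coeff-mulP p q n)) (≡.sym (∑-shift _ (suc n))))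

  coeff-sumP : ∀ f m n → coeff (sumP f m) n ≡ ∑ (λ j → coeff (f j) n) m
  coeff-sumP f zero    n = ≡.refl
  coeff-sumP f (suc m) n = ≡.trans (coeff-addP (sumP f m) (f m) n) (≡.cong (ℚ._+ coeff (f m) n) (coeff-sumP f m n))

  coeff-powP : ∀ p m → coeff (powP p m) ≋ coeff p ^ₛ m
  coeff-powP p zero    zero    = ≡.refl
  coeff-powP p zero    (suc n) = ≡.refl
  coeff-powP p (suc m)         = Sᵣ.trans (coeff-mulP p (powP p m)) (Sᵣ.*-congˡ {coeff p} (coeff-powP p m))

module RingIdentities (A : ℚ-Algebra) where
  open ℚ-Algebra A
  open Solver

  expand-tsB² : ∀ t y R K → t * ((emb ℚ.1ℚ + - (y * t)) * ((R * K) * (R * K)))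
                        ≈ ((t * R) * (K * K)) * ((emb ℚ.1ℚ + - ((fromℕ 2 * y) * t)) * R + - emb ℚ.1ℚ)
                          + (t * R) * (emb ℚ.1ℚ + y * (t * R)) * (K * K)
  expand-tsB² = solve 4 (λ t y R K → t :* ((con (+ 1) :+ :- (y :* t)) :* ((R :* K) :* (R :* K)))
                                := ((t :* R) :* (K :* K)) :* ((con (+ 1) :+ :- ((con (+ 2) :* y) :* t)) :* R :+ :- con (+ 1))
                                   :+ (t :* R) :* (con (+ 1) :+ y :* (t :* R)) :* (K :* K))
                      refl

  -- The defect of the conclusion is a combination of the defects of the three hypotheses.
  shifted-quadratic : ∀ x y t Y B → x ≈ emb ℚ.1ℚ + y
                    → (emb ℚ.1ℚ + - ((fromℕ 2 * y) * t)) * B ≈ emb ℚ.1ℚ + t * ((emb ℚ.1ℚ + - (y * t)) * (B * B))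
                    → (emb ℚ.1ℚ + - (y * t)) * Y ≈ y
                    → Y + B ≈ x + t * ((emb ℚ.1ℚ + - (y * t)) * ((Y + B) * (Y + B)))
  shifted-quadratic x y t Y B x≈ B≈ Y≈ = begin
    Y + B                   ≈⟨ solve 6 (λ x y t Y B Q → Y :+ B := Q :+ ((Y :+ B) :+ :- Q)) refl x y t Y B Q ⟩
    Q + ((Y + B) + - Q)     ≈⟨ +-congˡ (trans (difference x y t Y B) (+-cong (-‿cong (x-y≈ x≈)) (+-cong (x-y≈ B≈) (trans (*-congʳ (x-y≈ Y≈)) (zeroˡ _))))) ⟩
    Q + (- 0# + (0# + 0#))  ≈⟨ +-congˡ (trans (+-cong -0#≈0# (+-identityˡ 0#)) (+-identityˡ 0#)) ⟩
    Q + 0#                  ≈⟨ +-identityʳ Q ⟩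
    Q                       ∎
    where
    open import Relation.Binary.Reasoning.Setoid setoid
    open import Algebra.Properties.Ring ring using (-0#≈0#)
    Q = x + t * ((emb ℚ.1ℚ + - (y * t)) * ((Y + B) * (Y + B)))
    x-y≈ : ∀ {a b} → a ≈ b → a + - b ≈ 0#
    x-y≈ {a} {b} a≈b = trans (+-congʳ a≈b) (-‿inverseʳ b)
    difference : ∀ x y t Y B → (Y + B) + - (x + t * ((emb ℚ.1ℚ + - (y * t)) * ((Y + B) * (Y + B))))
               ≈ - (x + - (emb ℚ.1ℚ + y))
                 + (((emb ℚ.1ℚ + - ((fromℕ 2 * y) * t)) * B + - (emb ℚ.1ℚ + t * ((emb ℚ.1ℚ + - (y * t)) * (B * B))))
                    + ((emb ℚ.1ℚ + - (y * t)) * Y + - y) * (emb ℚ.1ℚ + - (t * Y) + - (fromℕ 2 * (t * B))))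
    difference = solve 5 (λ x y t Y B → (Y :+ B) :+ :- (x :+ t :* ((con (+ 1) :+ :- (y :* t)) :* ((Y :+ B) :* (Y :+ B))))
                                    := :- (x :+ :- (con (+ 1) :+ y))
                                       :+ (((con (+ 1) :+ :- ((con (+ 2) :* y) :* t)) :* B :+ :- (con (+ 1) :+ t :* ((con (+ 1) :+ :- (y :* t)) :* (B :* B))))
                                           :+ ((con (+ 1) :+ :- (y :* t)) :* Y :+ :- y) :* (con (+ 1) :+ :- (t :* Y) :+ :- (con (+ 2) :* (t :* B)))))
                         refl

  collect-x : ∀ x c p e q → x * (c * (p * (e * q))) ≈ c * (e * ((x * p) * q))
  collect-x = solve 5 (λ x c p e q → x :* (c :* (p :* (e :* q))) := c :* (e :* ((x :* p) :* q))) refl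

  regroup : ∀ g c p q → g * (c * (p * q)) ≈ (p * c) * (q * g)
  regroup = solve 4 (λ g c p q → g :* (c :* (p :* q)) := (p :* c) :* (q :* g)) refl

module GeneratingFunctions where
  open Catalan using (catalan; catalan-equation)
  module ℚ⟦x⟧ = SeriesOverℚ-Algebra ℚ-algebra

  ℚ⟦x⟧-algebra : ℚ-Algebra
  ℚ⟦x⟧-algebra = series-algebra ℚ-algebra

  private module A = ℚ-Algebra ℚ⟦x⟧-algebra
  open SeriesOverℚ-Algebra ℚ⟦x⟧-algebra
  module ⟦t⟧ = ℚ-Algebra (series-algebra ℚ⟦x⟧-algebra)

  x y w : A.Carrier
  x = ℚ⟦x⟧.t
  y = x A.+ A.- A.1#
  w = A.fromℕ 2 A.* y

  Cat : Series
  Cat = lift catalan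

  Cat-equation : Cat ≋ 𝟙 ⊕ t ⊛ (Cat ⊛ Cat)
  Cat-equation = lift-quadratic catalan catalan-equation

  -- ∑ g(L_d) t^d = Cat(t (1 + y t)).
  P : Series
  P = t ⊛ 1+ y ·t

  module ∘P = Composition P (t⊛-zero (1+ y ·t))
  open ∘P using (_∘P)

  G : Series
  G = Cat ∘P

  G-equation : G ≋ 𝟙 ⊕ P ⊛ (G ⊛ G)
  G-equation = ∘P.∘P-quadratic Cat Cat-equation

  -- ∑ x^(d+1) g(L_d)(1/x) t^d = x Cat(x t (1 - y t)).
  s : Series
  s = 1+ A.- y ·t

  φ : Series
  φ = t ⊛ (const x ⊛ s)

  module ∘φ = Composition φ (t⊛-zero (const x ⊛ s))
  open ∘φ using () renaming (_∘P to _∘φ)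

  L : Series
  L = const x ⊛ Cat ∘φ

  L-equation : L ≋ const x ⊕ t ⊛ (s ⊛ (L ⊛ L))
  L-equation = Sᵣ.trans (Sᵣ.*-congˡ {const x} (∘φ.∘P-quadratic Cat Cat-equation))
    (Sᵣ.trans (Sᵣ.distribˡ (const x) 𝟙 (φ ⊛ (Cat ∘φ ⊛ Cat ∘φ))) (Sᵣ.+-cong (Sᵣ.*-identityʳ (const x))
      (solve 4 (λ x t s H → x :* ((t :* (x :* s)) :* (H :* H)) := t :* (s :* ((x :* H) :* (x :* H)))) Sᵣ.refl (const x) t s (Cat ∘φ))))
    where open ⟦t⟧.Solver

  -- ∑ (∑ⱼ 2^(d-j) (d choose j) y^(d-j) g(L_j)) t^d = R G(t R) with R = 1/(1 - 2yt).
  R : Series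
  R = geometric w

  r : Series
  r = 1+ A.- w ·t

  U : Series
  U = t ⊛ R

  module ∘U = Composition U (t⊛-zero R)
  open ∘U using () renaming (_∘P to _∘U)

  K : Series
  K = G ∘U

  B : Series
  B = R ⊛ K

  r⊛B : r ⊛ B ≋ K
  r⊛B = Sᵣ.trans (Sᵣ.sym (Sᵣ.*-assoc r R K)) (Sᵣ.trans (Sᵣ.*-congʳ {K} (1-w·t⊛geometric w)) (Sᵣ.*-identityˡ K))

  K-equation : K ≋ 𝟙 ⊕ (U ⊛ (𝟙 ⊕ const y ⊛ U)) ⊛ (K ⊛ K)
  K-equation = Sᵣ.trans (∘U.∘P-cong G-equation) (Sᵣ.trans (∘U.∘P-+ 𝟙 (P ⊛ (G ⊛ G))) (Sᵣ.+-cong ∘U.∘P-𝟙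
    (Sᵣ.trans (∘U.∘P-⊛ P (G ⊛ G)) (Sᵣ.*-cong P∘U (∘U.∘P-⊛ G G)))))
    where
    P∘U : P ∘U ≋ U ⊛ (𝟙 ⊕ const y ⊛ U)
    P∘U = Sᵣ.trans (∘U.∘P-⊛ t (1+ y ·t)) (Sᵣ.*-cong ∘U.∘P-t (Sᵣ.trans (∘U.∘P-+ 𝟙 (const y ⊛ t))
            (Sᵣ.+-cong ∘U.∘P-𝟙 (Sᵣ.trans (∘U.∘P-⊛ (const y) t) (Sᵣ.*-cong (∘U.∘P-const y) ∘U.∘P-t)))))

  s≋1-yt : s ≋ 𝟙 ⊕ ⊝ (const y ⊛ t)
  s≋1-yt = Sᵣ.+-congˡ {𝟙} (Sᵣ.trans (Sᵣ.*-congʳ {t} (const‿- y)) (Sᵣ.sym (-‿distribˡ-* (const y) t)))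
    where open import Algebra.Properties.Ring Sᵣ.ring using (-‿distribˡ-*)

  r≋1-2yt : r ≋ 𝟙 ⊕ ⊝ ((⟦t⟧.fromℕ 2 ⊛ const y) ⊛ t)
  r≋1-2yt = Sᵣ.+-congˡ {𝟙} (Sᵣ.trans (Sᵣ.*-congʳ {t} (Sᵣ.trans (const‿- w) (Sᵣ.-‿cong (const-* (A.fromℕ 2) y))))
                                   (Sᵣ.sym (-‿distribˡ-* (⟦t⟧.fromℕ 2 ⊛ const y) t)))
    where open import Algebra.Properties.Ring Sᵣ.ring using (-‿distribˡ-*)

  open RingIdentities (series-algebra ℚ⟦x⟧-algebra) using (expand-tsB²; shifted-quadratic)

  -- Substituting K = r B, U = t R into K-equation; the discrepancy is a multiple of r R - 1 = 0.
  B-equation : r ⊛ B ≋ 𝟙 ⊕ t ⊛ (s ⊛ (B ⊛ B))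
  B-equation = Sᵣ.trans r⊛B (Sᵣ.trans K-equation (Sᵣ.+-congˡ {𝟙} (Sᵣ.sym difference≋0)))
    where
    open import Relation.Binary.Reasoning.Setoid Sᵣ.setoid
    open ⟦t⟧.Solver
    difference≋0 : t ⊛ (s ⊛ (B ⊛ B)) ≋ (U ⊛ (𝟙 ⊕ const y ⊛ U)) ⊛ (K ⊛ K)
    difference≋0 = begin
      t ⊛ (s ⊛ (B ⊛ B))
        ≈⟨ Sᵣ.*-congˡ {t} (Sᵣ.*-congʳ {B ⊛ B} s≋1-yt) ⟩
      t ⊛ ((𝟙 ⊕ ⊝ (const y ⊛ t)) ⊛ (B ⊛ B))
        ≈⟨ expand-tsB² t (const y) R K ⟩
      (U ⊛ (K ⊛ K)) ⊛ ((𝟙 ⊕ ⊝ ((⟦t⟧.fromℕ 2 ⊛ const y) ⊛ t)) ⊛ R ⊕ ⊝ 𝟙) ⊕ (U ⊛ (𝟙 ⊕ const y ⊛ U)) ⊛ (K ⊛ K)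
        ≈⟨ Sᵣ.+-congʳ (Sᵣ.*-congˡ {U ⊛ (K ⊛ K)} (Sᵣ.+-congʳ {⊝ 𝟙} (Sᵣ.trans (Sᵣ.*-congʳ {R} (Sᵣ.sym r≋1-2yt)) (1-w·t⊛geometric w)))) ⟩
      (U ⊛ (K ⊛ K)) ⊛ (𝟙 ⊕ ⊝ 𝟙) ⊕ (U ⊛ (𝟙 ⊕ const y ⊛ U)) ⊛ (K ⊛ K)
        ≈⟨ solve 3 (λ U K V → (U :* (K :* K)) :* (con (+ 1) :+ :- con (+ 1)) :+ V := V) Sᵣ.refl U K ((U ⊛ (𝟙 ⊕ const y ⊛ U)) ⊛ (K ⊛ K)) ⟩
      (U ⊛ (𝟙 ⊕ const y ⊛ U)) ⊛ (K ⊛ K) ∎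


  -- ∑ Q_{d,0} t^d = Y + B with Y = ∑ y^(d+1) t^d.
  Y : Series
  Y n = y ^ suc n

  s⊛Y : s ⊛ Y ≋ const y
  s⊛Y zero    = A.trans (1+b·t⊛-zero (A.- y) Y) (A.*-identityʳ y)
  s⊛Y (suc k) = A.trans (1+b·t⊛-suc (A.- y) Y k)
    (A.trans (A.sym (A.distribʳ (Y k) y (A.- y))) (A.trans (A.*-congʳ {Y k} (A.-‿inverseʳ y)) (A.zeroˡ (Y k))))

  M : Series
  M = Y ⊕ B

  M-equation : M ≋ const x ⊕ t ⊛ (s ⊛ (M ⊛ M))
  M-equation = Sᵣ.trans (shifted-quadratic (const x) (const y) t Y B x≈1+y r⊛B≈ s⊛Y≈) (Sᵣ.+-congˡ {const x} (Sᵣ.*-congˡ {t} (Sᵣ.*-congʳ {M ⊛ M} (Sᵣ.sym s≋1-yt))))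
    where
    x≈1+y : const x ≋ 𝟙 ⊕ const y
    x≈1+y zero    = A.sym (A.trans (A.+-comm A.1# (x A.+ A.- A.1#)) (A.trans (A.+-assoc x (A.- A.1#) A.1#)
                      (A.trans (A.+-congˡ {x} (A.-‿inverseˡ A.1#)) (A.+-identityʳ x))))
    x≈1+y (suc n) = A.sym (A.+-identityˡ A.0#)
    r⊛B≈ : (𝟙 ⊕ ⊝ ((⟦t⟧.fromℕ 2 ⊛ const y) ⊛ t)) ⊛ B ≋ 𝟙 ⊕ t ⊛ ((𝟙 ⊕ ⊝ (const y ⊛ t)) ⊛ (B ⊛ B))
    r⊛B≈ = Sᵣ.trans (Sᵣ.*-congʳ {B} (Sᵣ.sym r≋1-2yt)) (Sᵣ.trans B-equation (Sᵣ.+-congˡ {𝟙} (Sᵣ.*-congˡ {t} (Sᵣ.*-congʳ {B ⊛ B} s≋1-yt))))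
    s⊛Y≈ : (𝟙 ⊕ ⊝ (const y ⊛ t)) ⊛ Y ≋ const y
    s⊛Y≈ = Sᵣ.trans (Sᵣ.*-congʳ {Y} (Sᵣ.sym s≋1-yt)) s⊛Y

  L≋M : L ≋ M
  L≋M = quadratic-unique {const x} {s} L-equation M-equation

module CoefficientExtraction where
  open GeneratingFunctions
  open Catalan using (catalan)
  open PolynomialCoefficients
  open import Data.Nat.DivMod using (m/n≤m)
  private module A = ℚ-Algebra ℚ⟦x⟧-algebra
  open SeriesOverℚ-Algebra ℚ⟦x⟧-algebra
  open RingIdentities ℚ⟦x⟧-algebra using (collect-x; regroup)
  open ∘φ using () renaming (_∘P to _∘φ)
  private module ℚ-Solver = ℚ-Algebra.Solver ℚ-algebra

  P^n-coeff : ∀ n d → n ≤ d → (P ^ₛ n) d A.≈ A.fromℕ (n C (d ∸ n)) A.* y ^ (d ∸ n)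
  P^n-coeff n d n≤d = A.trans ([t⊛g]^n-≥ (1+ y ·t) n d n≤d) (binomial y n (d ∸ n))

  φ^n-coeff : ∀ n d → n ≤ d → (φ ^ₛ n) d A.≈ x ^ n A.* (A.fromℕ (n C (d ∸ n)) A.* (A.- y) ^ (d ∸ n))
  φ^n-coeff n d n≤d = A.trans ([t⊛g]^n-≥ (const x ⊛ s) n d n≤d) (A.trans (^ₛ-distrib-⊛ (const x) s n (d ∸ n))
    (A.trans (⊛-cong {const x ^ₛ n} {const (x ^ n)} {s ^ₛ n} (const-^ x n) (λ _ → A.refl) (d ∸ n))
      (A.trans (const-⊛ (x ^ n) (s ^ₛ n) (d ∸ n)) (A.*-congˡ {x ^ n} (binomial (A.- y) n (d ∸ n))))))

  R⊛U^j-coeff : ∀ j d → j ≤ d → (R ⊛ U ^ₛ j) d A.≈ A.fromℕ (d C j) A.* w ^ (d ∸ j)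
  R⊛U^j-coeff j d j≤d = A.trans (Sᵣ.*-congˡ {R} (^ₛ-distrib-⊛ t R j) d) (A.trans (x∙yz≈y∙xz R (t ^ₛ j) (R ^ₛ j) d)
    (A.trans (t^n⊛-≥ j (R ⊛ R ^ₛ j) d j≤d) (A.trans (geometric^-coeff w j (d ∸ j))
      (A.reflexive (≡.cong (λ m → A.fromℕ (m C j) A.* w ^ (d ∸ j)) (m∸n+n≡m j≤d))))))
    where open import Algebra.Properties.CommutativeSemigroup Sᵣ.*-commutativeSemigroup using (x∙yz≈y∙xz)

  G-coeff : ∀ d → G d A.≈ ∑ (λ n → Cat n A.* (A.fromℕ (n C (d ∸ n)) A.* y ^ (d ∸ n))) (suc d)
  G-coeff d = ∑-cong< (suc d) (λ n n<1+d → A.*-congˡ {Cat n} (P^n-coeff n d (≤-pred n<1+d)))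

  L-coeff : ∀ d → L d A.≈ x A.* ∑ (λ n → Cat n A.* (x ^ n A.* (A.fromℕ (n C (d ∸ n)) A.* (A.- y) ^ (d ∸ n)))) (suc d)
  L-coeff d = A.trans (const-⊛ x (Cat ∘φ) d) (A.*-congˡ {x} (∑-cong< (suc d) (λ n n<1+d → A.*-congˡ {Cat n} (φ^n-coeff n d (≤-pred n<1+d)))))

  B-coeff : ∀ d → B d A.≈ ∑ (λ j → G j A.* (A.fromℕ (d C j) A.* w ^ (d ∸ j))) (suc d)
  B-coeff d = A.trans (∘U.⊛-∘P R G d) (∑-cong< (suc d) (λ j j<1+d → A.*-congˡ {G j} (R⊛U^j-coeff j d (≤-pred j<1+d))))

  private
    open ℚ⟦x⟧ using () renaming (_^_ to _^ℚ_)

    -1ℚ : ℚ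
    -1ℚ = ℚ.- ℚ.1ℚ

    1-x≋ : A.- y ℚ⟦x⟧.≋ ℚ⟦x⟧.1+ -1ℚ ·t
    1-x≋ zero          = ≡.sym (≡.cong (ℚ.1ℚ ℚ.+_) (ℚ⟦x⟧.const-⊛ -1ℚ ℚ⟦x⟧.t 0))
    1-x≋ (suc zero)    = ≡.sym (≡.cong (ℚ.0ℚ ℚ.+_) (ℚ⟦x⟧.const-⊛ -1ℚ ℚ⟦x⟧.t 1))
    1-x≋ (suc (suc n)) = ≡.sym (≡.cong (ℚ.0ℚ ℚ.+_) (ℚ⟦x⟧.const-⊛ -1ℚ ℚ⟦x⟧.t (2 ℕ.+ n)))

    x-1≋ : y ℚ⟦x⟧.≋ ℚ⟦x⟧.const -1ℚ ℚ⟦x⟧.⊛ A.- y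
    x-1≋ zero          = ≡.sym (ℚ⟦x⟧.const-⊛ -1ℚ (A.- y) 0)
    x-1≋ (suc zero)    = ≡.sym (ℚ⟦x⟧.const-⊛ -1ℚ (A.- y) 1)
    x-1≋ (suc (suc n)) = ≡.sym (ℚ⟦x⟧.const-⊛ -1ℚ (A.- y) (2 ℕ.+ n))

    [1-x]^m-coeff : ∀ m j → ((A.- y) ^ m) j ≡ ℕtoℚ (m C j) ℚ.* (-1ℚ ^ℚ j)
    [1-x]^m-coeff m j = ≡.trans (ℚ⟦x⟧.^ₛ-congˡ m 1-x≋ j) (ℚ⟦x⟧.binomial -1ℚ m j)

    [x-1]^m-coeff : ∀ m j → (y ^ m) j ≡ (-1ℚ ^ℚ m) ℚ.* (ℕtoℚ (m C j) ℚ.* (-1ℚ ^ℚ j))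
    [x-1]^m-coeff m j = begin
      (y ^ m) j                                                 ≡⟨ ℚ⟦x⟧.^ₛ-congˡ m x-1≋ j ⟩
      ((ℚ⟦x⟧.const -1ℚ ℚ⟦x⟧.⊛ A.- y) ^ m) j                     ≡⟨ ℚ⟦x⟧.^ₛ-distrib-⊛ (ℚ⟦x⟧.const -1ℚ) (A.- y) m j ⟩
      (ℚ⟦x⟧.const -1ℚ ℚ⟦x⟧.^ₛ m ℚ⟦x⟧.⊛ (A.- y) ^ m) j          ≡⟨ ℚ⟦x⟧.⊛-cong {g = (A.- y) ^ m} (ℚ⟦x⟧.const-^ -1ℚ m) (λ _ → ≡.refl) j ⟩
      (ℚ⟦x⟧.const (-1ℚ ^ℚ m) ℚ⟦x⟧.⊛ (A.- y) ^ m) j              ≡⟨ ℚ⟦x⟧.const-⊛ (-1ℚ ^ℚ m) ((A.- y) ^ m) j ⟩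
      (-1ℚ ^ℚ m) ℚ.* ((A.- y) ^ m) j                            ≡⟨ ≡.cong ((-1ℚ ^ℚ m) ℚ.*_) ([1-x]^m-coeff m j) ⟩
      (-1ℚ ^ℚ m) ℚ.* (ℕtoℚ (m C j) ℚ.* (-1ℚ ^ℚ j))              ∎
      where open ≡.≡-Reasoning

  -- Reversing the coefficients of (x - 1)^m gives (1 - x)^m.
  reversal : ∀ n m ℓ → ℓ ≤ n ℕ.+ m → (x ^ suc n A.* (A.- y) ^ m) (suc (n ℕ.+ m) ∸ ℓ) ≡ (y ^ m) ℓ
  reversal n m ℓ ℓ≤n+m with ℓ ℕ.≤? m
  ... | yes ℓ≤m = begin
    (x ^ suc n A.* (A.- y) ^ m) (suc (n ℕ.+ m) ∸ ℓ)   ≡⟨ ℚ⟦x⟧.t^n⊛-≥ (suc n) ((A.- y) ^ m) _ 1+n≤ ⟩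
    ((A.- y) ^ m) (suc (n ℕ.+ m) ∸ ℓ ∸ suc n)         ≡⟨ ≡.cong ((A.- y) ^ m) index ⟩
    ((A.- y) ^ m) (m ∸ ℓ)                              ≡⟨ [1-x]^m-coeff m (m ∸ ℓ) ⟩
    ℕtoℚ (m C (m ∸ ℓ)) ℚ.* (-1ℚ ^ℚ (m ∸ ℓ))           ≡⟨ ≡.cong (λ c → ℕtoℚ c ℚ.* (-1ℚ ^ℚ (m ∸ ℓ))) (≡.sym (nCk≡nC[n∸k] ℓ≤m)) ⟩
    ℕtoℚ (m C ℓ) ℚ.* (-1ℚ ^ℚ (m ∸ ℓ))                 ≡⟨ sign ⟩
    (-1ℚ ^ℚ m) ℚ.* (ℕtoℚ (m C ℓ) ℚ.* (-1ℚ ^ℚ ℓ))      ≡⟨ ≡.sym ([x-1]^m-coeff m ℓ) ⟩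
    (y ^ m) ℓ                                          ∎
    where
    open ≡.≡-Reasoning
    1+n≤ : suc n ≤ suc (n ℕ.+ m) ∸ ℓ
    1+n≤ = ≡.subst (suc n ≤_) (≡.sym (+-∸-assoc (suc n) ℓ≤m)) (m≤m+n (suc n) (m ∸ ℓ))
    index : suc (n ℕ.+ m) ∸ ℓ ∸ suc n ≡ m ∸ ℓ
    index = ≡.trans (≡.cong (_∸ suc n) (+-∸-assoc (suc n) ℓ≤m)) (m+n∸m≡n (suc n) (m ∸ ℓ))
    -1²≡1 : ∀ j → (-1ℚ ^ℚ j) ℚ.* (-1ℚ ^ℚ j) ≡ ℚ.1ℚ
    -1²≡1 zero    = ≡.refl
    -1²≡1 (suc j) = ≡.trans (ℚ-Solver.solve 2 (λ a b → (a :* b) :* (a :* b) := (a :* a) :* (b :* b)) ≡.refl -1ℚ (-1ℚ ^ℚ j))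
                            (≡.trans (ℚₚ.*-identityˡ _) (-1²≡1 j))
      where open ℚ-Solver
    sign : ℕtoℚ (m C ℓ) ℚ.* (-1ℚ ^ℚ (m ∸ ℓ)) ≡ (-1ℚ ^ℚ m) ℚ.* (ℕtoℚ (m C ℓ) ℚ.* (-1ℚ ^ℚ ℓ))
    sign = begin
      c ℚ.* p                        ≡⟨ ≡.sym (ℚₚ.*-identityʳ (c ℚ.* p)) ⟩
      (c ℚ.* p) ℚ.* ℚ.1ℚ             ≡⟨ ≡.cong ((c ℚ.* p) ℚ.*_) (≡.sym (-1²≡1 ℓ)) ⟩
      (c ℚ.* p) ℚ.* (q ℚ.* q)        ≡⟨ ℚ-Solver.solve 3 (λ c p q → (c :* p) :* (q :* q) := (p :* q) :* (c :* q)) ≡.refl c p q ⟩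
      (p ℚ.* q) ℚ.* (c ℚ.* q)        ≡⟨ ≡.cong (ℚ._* (c ℚ.* q)) (≡.trans (≡.sym (ℚ⟦x⟧.^-homo-* -1ℚ (m ∸ ℓ) ℓ))
                                                                          (≡.cong (-1ℚ ^ℚ_) (m∸n+n≡m ℓ≤m))) ⟩
      (-1ℚ ^ℚ m) ℚ.* (c ℚ.* q)       ∎
      where
      open ℚ-Solver using (_:*_; _:=_)
      c = ℕtoℚ (m C ℓ)
      p = -1ℚ ^ℚ (m ∸ ℓ)
      q = -1ℚ ^ℚ ℓ
  ... | no ℓ≰m = begin
    (x ^ suc n A.* (A.- y) ^ m) (suc (n ℕ.+ m) ∸ ℓ)     ≡⟨ ℚ⟦x⟧.t^n⊛-< (suc n) ((A.- y) ^ m) _ below ⟩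
    ℚ.0ℚ                                                 ≡⟨ ≡.sym (ℚₚ.*-zeroʳ (-1ℚ ^ℚ m)) ⟩
    (-1ℚ ^ℚ m) ℚ.* ℚ.0ℚ                                  ≡⟨ ≡.cong ((-1ℚ ^ℚ m) ℚ.*_) (≡.sym (ℚₚ.*-zeroˡ (-1ℚ ^ℚ ℓ))) ⟩
    (-1ℚ ^ℚ m) ℚ.* (ℚ.0ℚ ℚ.* (-1ℚ ^ℚ ℓ))                 ≡⟨ ≡.cong (λ c → (-1ℚ ^ℚ m) ℚ.* (ℕtoℚ c ℚ.* (-1ℚ ^ℚ ℓ))) (≡.sym (k>n⇒nCk≡0 (≰⇒> ℓ≰m))) ⟩
    (-1ℚ ^ℚ m) ℚ.* (ℕtoℚ (m C ℓ) ℚ.* (-1ℚ ^ℚ ℓ))        ≡⟨ ≡.sym ([x-1]^m-coeff m ℓ) ⟩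
    (y ^ m) ℓ                                            ∎
    where
    open ≡.≡-Reasoning
    below : suc (n ℕ.+ m) ∸ ℓ < suc n
    below = s≤s (≡.subst (suc (n ℕ.+ m) ∸ ℓ ≤_) (m+n∸n≡m n m) (∸-monoʳ-≤ (suc (n ℕ.+ m)) (≰⇒> ℓ≰m)))

  G-coeffℚ : ∀ d ℓ → G d ℓ ≡ ℚ⟦x⟧.∑ (λ n → catalan n ℚ.* (ℕtoℚ (n C (d ∸ n)) ℚ.* (y ^ (d ∸ n)) ℓ)) (suc d)
  G-coeffℚ d ℓ = ≡.trans (G-coeff d ℓ) (≡.trans (ℚ⟦x⟧.∑ₛ-coeff (λ n → Cat n A.* (A.fromℕ (n C (d ∸ n)) A.* y ^ (d ∸ n))) (suc d) ℓ)
    (ℚ⟦x⟧.∑-cong (suc d) (λ n → ≡.trans (ℚ⟦x⟧.const-⊛ (catalan n) (A.fromℕ (n C (d ∸ n)) A.* y ^ (d ∸ n)) ℓ)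
      (≡.cong (catalan n ℚ.*_) (ℚ⟦x⟧.const-⊛ (ℕtoℚ (n C (d ∸ n))) (y ^ (d ∸ n)) ℓ)))))

  L-coeffℚ : ∀ d k → L d k ≡ ℚ⟦x⟧.∑ (λ n → catalan n ℚ.* (ℕtoℚ (n C (d ∸ n)) ℚ.* (x ^ suc n A.* (A.- y) ^ (d ∸ n)) k)) (suc d)
  L-coeffℚ d k = ≡.trans (L-coeff d k) (≡.trans (*-distribˡ-∑ x term (suc d) k) (≡.trans (ℚ⟦x⟧.∑ₛ-coeff (λ n → x A.* term n) (suc d) k)
    (ℚ⟦x⟧.∑-cong (suc d) (λ n → ≡.trans (collect-x x (Cat n) (x ^ n) (A.fromℕ (n C (d ∸ n))) ((A.- y) ^ (d ∸ n)) k)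
      (≡.trans (ℚ⟦x⟧.const-⊛ (catalan n) (A.fromℕ (n C (d ∸ n)) A.* (x ^ suc n A.* (A.- y) ^ (d ∸ n))) k)
        (≡.cong (catalan n ℚ.*_) (ℚ⟦x⟧.const-⊛ (ℕtoℚ (n C (d ∸ n))) (x ^ suc n A.* (A.- y) ^ (d ∸ n)) k)))))))
    where term = λ n → Cat n A.* (x ^ n A.* (A.fromℕ (n C (d ∸ n)) A.* (A.- y) ^ (d ∸ n)))

  L-reverses-G : ∀ d ℓ → ℓ ≤ d → L d (suc d ∸ ℓ) ≡ G d ℓ
  L-reverses-G d ℓ ℓ≤d = ≡.trans (L-coeffℚ d (suc d ∸ ℓ)) (≡.trans (ℚ⟦x⟧.∑-cong< (suc d) (λ n n<1+d →
    ≡.cong (λ c → catalan n ℚ.* (ℕtoℚ (n C (d ∸ n)) ℚ.* c)) (term n (≤-pred n<1+d)))) (≡.sym (G-coeffℚ d ℓ)))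
    where
    term : ∀ n → n ≤ d → (x ^ suc n A.* (A.- y) ^ (d ∸ n)) (suc d ∸ ℓ) ≡ (y ^ (d ∸ n)) ℓ
    term n n≤d = ≡.trans (≡.cong (λ m → (x ^ suc n A.* (A.- y) ^ (d ∸ n)) (suc m ∸ ℓ)) (≡.sym n+[d∸n]≡d))
                         (reversal n (d ∸ n) ℓ (≡.subst (ℓ ≤_) (≡.sym n+[d∸n]≡d) ℓ≤d))
      where n+[d∸n]≡d = m+[n∸m]≡n n≤d

  g-coefficient : ℕ → ℕ → ℚ
  g-coefficient j m = + ((j C m) ℕ.* ((2 ℕ.* j ∸ 2 ℕ.* m) C j)) ℚ./ suc (j ∸ m)

  catalan*binomial : ∀ n m → m ≤ n → catalan n ℚ.* ℕtoℚ (n C m) ≡ g-coefficient (n ℕ.+ m) m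
  catalan*binomial n m m≤n = begin
    catalan n ℚ.* ℕtoℚ (n C m)
      ≡⟨ [a/n]*b≡[a*b]/n ((n ℕ.+ n) C n) (n C m) n ⟩
    + (((n ℕ.+ n) C n) ℕ.* (n C m)) ℚ./ suc n
      ≡⟨ ≡.cong (λ k → + k ℚ./ suc n) (≡.sym ([n+m]Cm*[n+n]C[n+m]≡[n+n]Cn*nCm n m m≤n)) ⟩
    + (((n ℕ.+ m) C m) ℕ.* ((n ℕ.+ n) C (n ℕ.+ m))) ℚ./ suc n
      ≡⟨ ≡.cong₂ (λ k l → + (((n ℕ.+ m) C m) ℕ.* (k C (n ℕ.+ m))) ℚ./ suc l) (≡.sym 2[n+m]∸2m≡n+n) (≡.sym (m+n∸n≡m n m)) ⟩
    g-coefficient (n ℕ.+ m) m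
      ∎
    where
    open ≡.≡-Reasoning
    open BinomialIdentities using ([n+m]Cm*[n+n]C[n+m]≡[n+n]Cn*nCm)
    2[n+m]∸2m≡n+n : 2 ℕ.* (n ℕ.+ m) ∸ 2 ℕ.* m ≡ n ℕ.+ n
    2[n+m]∸2m≡n+n = ≡.trans (≡.sym (ℕₚ.*-distribˡ-∸ 2 (n ℕ.+ m) m))
                           (≡.trans (≡.cong (2 ℕ.*_) (m+n∸n≡m n m)) (≡.cong (n ℕ.+_) (ℕₚ.+-identityʳ n)))

  x-1-powers : ∀ m → coeff (powP xm1 m) ℚ⟦x⟧.≋ y ^ m
  x-1-powers m = ℚ⟦x⟧.Sᵣ.trans (coeff-powP xm1 m) (ℚ⟦x⟧.^ₛ-congˡ m coeff-xm1)
    where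
    coeff-xm1 : coeff xm1 ℚ⟦x⟧.≋ y
    coeff-xm1 zero          = ≡.refl
    coeff-xm1 (suc zero)    = ≡.refl
    coeff-xm1 (suc (suc n)) = ≡.refl

  gL≋G : ∀ d → coeff (gL d) ℚ⟦x⟧.≋ G d
  gL≋G d ℓ = begin
    coeff (gL d) ℓ
      ≡⟨ coeff-sumP _ (suc (d / 2)) ℓ ⟩
    ℚ⟦x⟧.∑ (λ m → coeff (scaleP (g-coefficient d m) (powP xm1 m)) ℓ) (suc (d / 2))
      ≡⟨ ℚ⟦x⟧.∑-cong< (suc (d / 2)) (λ m m<1+d/2 → ≡.trans (coeff-scaleP (g-coefficient d m) (powP xm1 m) ℓ)
           (≡.cong₂ ℚ._*_ (≡.sym (catalan*binomial′ m (≤-pred m<1+d/2))) (x-1-powers m ℓ))) ⟩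
    ℚ⟦x⟧.∑ (λ m → (catalan (d ∸ m) ℚ.* ℕtoℚ ((d ∸ m) C m)) ℚ.* (y ^ m) ℓ) (suc (d / 2))
      ≡⟨ ℚ⟦x⟧.∑-cong (suc (d / 2)) (λ m → ℚₚ.*-assoc (catalan (d ∸ m)) _ _) ⟩
    ℚ⟦x⟧.∑ T (suc (d / 2))
      ≡⟨ ≡.sym (ℚ⟦x⟧.∑-extend (suc (d / 2)) (suc d) (s≤s (m/n≤m d 2)) vanishing) ⟩
    ℚ⟦x⟧.∑ T (suc d)
      ≡⟨ ℚ⟦x⟧.∑-reverse T (suc d) ⟩
    ℚ⟦x⟧.∑ (λ n → T (d ∸ n)) (suc d)
      ≡⟨ ℚ⟦x⟧.∑-cong< (suc d) (λ n n<1+d → ≡.cong (λ k → catalan k ℚ.* (ℕtoℚ (k C (d ∸ n)) ℚ.* (y ^ (d ∸ n)) ℓ))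
           (m∸[m∸n]≡n (≤-pred n<1+d))) ⟩
    ℚ⟦x⟧.∑ (λ n → catalan n ℚ.* (ℕtoℚ (n C (d ∸ n)) ℚ.* (y ^ (d ∸ n)) ℓ)) (suc d)
      ≡⟨ ≡.sym (G-coeffℚ d ℓ) ⟩
    G d ℓ ∎
    where
    open ≡.≡-Reasoning
    T : ℕ → ℚ
    T m = catalan (d ∸ m) ℚ.* (ℕtoℚ ((d ∸ m) C m) ℚ.* (y ^ m) ℓ)
    catalan*binomial′ : ∀ m → m ≤ d / 2 → catalan (d ∸ m) ℚ.* ℕtoℚ ((d ∸ m) C m) ≡ g-coefficient d m
    catalan*binomial′ m m≤d/2 = ≡.trans (catalan*binomial (d ∸ m) m (m+n≤o⇒m≤o∸n m m+m≤d))
                                        (≡.cong (λ j → g-coefficient j m) (m∸n+n≡m (≤-trans (m≤n+m m m) m+m≤d)))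
      where m+m≤d = Halving.m≤n/2⇒m+m≤n m≤d/2
    vanishing : ∀ m → suc (d / 2) ≤ m → m < suc d → T m ≡ ℚ.0ℚ
    vanishing m d/2<m _ = ≡.trans (≡.cong (λ c → catalan (d ∸ m) ℚ.* (ℕtoℚ c ℚ.* (y ^ m) ℓ))
                                          (k>n⇒nCk≡0 (m<n+o⇒m∸n<o d m {{ℕ.>-nonZero (≤-trans (s≤s z≤n) d/2<m)}} (Halving.n/2<m⇒n<m+m d/2<m))))
                                  (≡.trans (≡.cong (catalan (d ∸ m) ℚ.*_) (ℚₚ.*-zeroˡ ((y ^ m) ℓ))) (ℚₚ.*-zeroʳ (catalan (d ∸ m))))

  Q0≋M : ∀ d → coeff (Q0 d) ℚ⟦x⟧.≋ M d
  Q0≋M d k = ≡.trans (coeff-addP (powP xm1 (suc d)) (sumP term (suc d)) k)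
                     (≡.cong₂ ℚ._+_ (x-1-powers (suc d) k) (≡.trans terms (≡.sym B-terms)))
    where
    c : ℕ → ℚ
    c j = ℕtoℚ (2 ℕ.^ (d ∸ j) ℕ.* (d C j))
    term : ℕ → Poly
    term j = scaleP (c j) (mulP (powP xm1 (d ∸ j)) (gL j))
    terms : coeff (sumP term (suc d)) k ≡ ℚ⟦x⟧.∑ (λ j → c j ℚ.* (y ^ (d ∸ j) A.* G j) k) (suc d)
    terms = ≡.trans (coeff-sumP term (suc d) k) (ℚ⟦x⟧.∑-cong (suc d) (λ j →
      ≡.trans (coeff-scaleP (c j) (mulP (powP xm1 (d ∸ j)) (gL j)) k) (≡.cong (c j ℚ.*_)
        (≡.trans (coeff-mulP (powP xm1 (d ∸ j)) (gL j) k) (ℚ⟦x⟧.⊛-cong (x-1-powers (d ∸ j)) (gL≋G j) k)))))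
    rescale : ∀ j → G j A.* (A.fromℕ (d C j) A.* w ^ (d ∸ j)) A.≈ A.fromℕ (2 ℕ.^ (d ∸ j) ℕ.* (d C j)) A.* (y ^ (d ∸ j) A.* G j)
    rescale j = A.trans (A.*-congˡ {G j} (A.*-congˡ {A.fromℕ (d C j)} (^-distrib-* (A.fromℕ 2) y (d ∸ j))))
      (A.trans (regroup (G j) (A.fromℕ (d C j)) (A.fromℕ 2 ^ (d ∸ j)) (y ^ (d ∸ j)))
        (A.*-congʳ {y ^ (d ∸ j) A.* G j} (A.trans (A.*-congʳ {A.fromℕ (d C j)} (fromℕ-^ 2 (d ∸ j)))
          (A.sym (A.fromℕ-* (2 ℕ.^ (d ∸ j)) (d C j))))))
    B-terms : B d k ≡ ℚ⟦x⟧.∑ (λ j → c j ℚ.* (y ^ (d ∸ j) A.* G j) k) (suc d)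
    B-terms = ≡.trans (B-coeff d k) (≡.trans (ℚ⟦x⟧.∑ₛ-coeff (λ j → G j A.* (A.fromℕ (d C j) A.* w ^ (d ∸ j))) (suc d) k)
      (ℚ⟦x⟧.∑-cong (suc d) (λ j → ≡.trans (rescale j k) (ℚ⟦x⟧.const-⊛ (c j) (y ^ (d ∸ j) A.* G j) k))))

open GeneratingFunctions using (G; L; M; L≋M)
open CoefficientExtraction using (gL≋G; L-reverses-G; Q0≋M)
open import Data.Nat.DivMod using (m/n≤m)

lemma5p4 : (d ℓ : ℕ) → ℓ ≤ d / 2 → coeff (Qlast d) ℓ ≡ coeff (Q0 d) (suc d ∸ ℓ)
lemma5p4 d ℓ ℓ≤d/2 = begin
  coeff (gL d) ℓ             ≡⟨ gL≋G d ℓ ⟩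
  G d ℓ                      ≡⟨ ≡.sym (L-reverses-G d ℓ (≤-trans ℓ≤d/2 (m/n≤m d 2))) ⟩
  L d (suc d ∸ ℓ)            ≡⟨ L≋M d (suc d ∸ ℓ) ⟩
  M d (suc d ∸ ℓ)            ≡⟨ ≡.sym (Q0≋M d (suc d ∸ ℓ)) ⟩
  coeff (Q0 d) (suc d ∸ ℓ)   ∎
  where open ≡.≡-Reasoning
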